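{- For every positive integer $k$, $$G^C_k(q;a,c,d)=(cq;q)_{k+1}\sum_{j=0}^{k+1}\frac{u_j(a,c,c,d)\,q^{\binom{k+1-j}{2}}}{(q;q)_{k+1-j}},$$ where $u_j(a,b,c,d)$ is defined for all $n\ge0$ by $$u_{2n}(a,b,c,d)=(1-b)\sum_{\ell=0}^{n}\frac{(-aq^{2\ell+1};q^2)_{n-\ell}(-dq^{2\ell+1};q^2)_{n-\ell}}{(bq^{2\ell};q^2)_{n-\ell+1}(cq^{2\ell+1};q^2)_{n-\ell}}\frac{q^{2\ell}}{(q;q)_{2\ell}},$$ $$u_{2n+1}(a,b,c,d)=(b-1)\sum_{\ell=0}^{n}\frac{(-aq^{2\ell+2};q^2)_{n-\ell}(-dq^{2\ell+2};q^2)_{n-\ell}}{(bq^{2\ell+1};q^2)_{n-\ell+1}(cq^{2\ell+2};q^2)_{n-\ell}}\frac{q^{2\ell+1}}{(q;q)_{2\ell+1}},$$ and $u_j(a,c,c,d)$ denotes its specialisation $b=c$.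
   Context: $(x;q)_n=\prod_{i=0}^{n-1}(1-xq^i)$. A coloured integer $m_x$ is a positive integer $m$ (its value) with a colour $x\in\{a,c,d\}$, totally ordered by $1_a<1_c<1_d<2_a<2_c<2_d<\cdots$. Let $\mathcal{C}$ be the set of finite non-increasing (in this order, possibly empty) sequences of coloured integers such that consecutive parts $m_x$ (larger) and $m'_y$ (next) satisfy $m-m'\ge C(x,y)$, where $C(a,a)=C(a,c)=C(a,d)=2$; $C(c,a)=1,C(c,c)=1,C(c,d)=2$; $C(d,a)=0,C(d,c)=1,C(d,d)=2$. $G^C_k(q;a,c,d)=\sum_\lambda q^{|\lambda|}a^{\#_a}c^{\#_c}d^{\#_d}$ over $\lambda\in\mathcal{C}$ with all parts of value $\le k$, where $|\lambda|$ is the sum of values and $\#_x$ the number of parts of colour $x$. -}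

module Defs where

open import Data.Nat as ℕ using (ℕ; zero; suc; _∸_; _≤ᵇ_)
open import Data.Nat.Combinatorics using (_C_)
open import Data.Bool using (Bool; true; false; _∧_; if_then_else_)
open import Data.List as List using (List; []; _∷_; _++_; filter)
open import Data.Sum using (_⊎_; inj₁; inj₂)
open import Data.Integer using (+_)
open import Data.Rational as ℚ using (ℚ; 0ℚ; 1ℚ; _+_; _*_; _-_; -_; 1/_; ≢-nonZero)
open import Data.Rational.Properties using (_≟_)
open import Relation.Nullary using (yes; no)

infixr 8 _^_
infixl 7 _÷_
_^_ : ℚ → ℕ → ℚ
x ^ zero  = 1ℚ
x ^ suc n = x * (x ^ n)

-- total inverse (only ever applied to nonzero values in the statement,
-- where it agrees with the genuine inverse 1/ x)
inv : ℚ → ℚ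
inv x with x ≟ 0ℚ
... | yes _  = 0ℚ
... | no x≢0 = 1/_ x {{≢-nonZero x≢0}}

_÷_ : ℚ → ℚ → ℚ
x ÷ y = x * inv y

Σ< : ℕ → (ℕ → ℚ) → ℚ
Σ< zero    f = 0ℚ
Σ< (suc n) f = Σ< n f + f n

Π< : ℕ → (ℕ → ℚ) → ℚ
Π< zero    f = 1ℚ
Π< (suc n) f = Π< n f * f n

poch : ℚ → ℚ → ℕ → ℚ
poch x p n = Π< n (λ i → 1ℚ - x * (p ^ i))

parity : ℕ → ℕ ⊎ ℕ
parity zero          = inj₁ zero
parity (suc zero)    = inj₂ zero
parity (suc (suc j)) with parity j
... | inj₁ n = inj₁ (suc n)
... | inj₂ n = inj₂ (suc n)

uEven : (q a b c d : ℚ) → ℕ → ℚ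
uEven q a b c d n = (1ℚ - b) * Σ< (suc n) term
  where
  q² = q ^ 2
  term : ℕ → ℚ
  term ℓ =
    ((poch (- a * q ^ (2 ℕ.* ℓ ℕ.+ 1)) q² (n ∸ ℓ)
       * poch (- d * q ^ (2 ℕ.* ℓ ℕ.+ 1)) q² (n ∸ ℓ))
     ÷ (poch (b * q ^ (2 ℕ.* ℓ)) q² (n ∸ ℓ ℕ.+ 1)
       * poch (c * q ^ (2 ℕ.* ℓ ℕ.+ 1)) q² (n ∸ ℓ)))
    * (q ^ (2 ℕ.* ℓ) ÷ poch q q (2 ℕ.* ℓ))

uOdd : (q a b c d : ℚ) → ℕ → ℚ
uOdd q a b c d n = (b - 1ℚ) * Σ< (suc n) term
  where
  q² = q ^ 2
  term : ℕ → ℚ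
  term ℓ =
    ((poch (- a * q ^ (2 ℕ.* ℓ ℕ.+ 2)) q² (n ∸ ℓ)
       * poch (- d * q ^ (2 ℕ.* ℓ ℕ.+ 2)) q² (n ∸ ℓ))
     ÷ (poch (b * q ^ (2 ℕ.* ℓ ℕ.+ 1)) q² (n ∸ ℓ ℕ.+ 1)
       * poch (c * q ^ (2 ℕ.* ℓ ℕ.+ 2)) q² (n ∸ ℓ)))
    * (q ^ (2 ℕ.* ℓ ℕ.+ 1) ÷ poch q q (2 ℕ.* ℓ ℕ.+ 1))

u : (q a b c d : ℚ) → ℕ → ℚ
u q a b c d j with parity j
... | inj₁ n = uEven q a b c d n
... | inj₂ n = uOdd q a b c d n

RHS : (k : ℕ) (q a c d : ℚ) → ℚ
RHS k q a c d =
  poch (c * q) q (suc k)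
  * Σ< (suc (suc k)) (λ j →
      (u q a c c d j * q ^ ((suc k ∸ j) C 2)) ÷ poch q q (suc k ∸ j))

data Colour : Set where
  ca cc cd : Colour

rank : Colour → ℕ
rank ca = 0
rank cc = 1
rank cd = 2

record CInt : Set where
  constructor _,_
  field
    val : ℕ
    col : Colour
open CInt public

-- total order 1_a < 1_c < 1_d < 2_a < ... : compare 3·m + rank x
key : CInt → ℕ
key (m , x) = 3 ℕ.* m ℕ.+ rank x

-- minimal difference C(x,y) for a larger part of colour x followed by y
Cgap : Colour → Colour → ℕ
Cgap ca _  = 2
Cgap cc ca = 1
Cgap cc cc = 1
Cgap cc cd = 2
Cgap cd ca = 0
Cgap cd cc = 1
Cgap cd cd = 2

-- Boolean check of the defining conditions of 𝒞 on a sequence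
-- (all values positive, non-increasing in the coloured order,
--  and m - m' ≥ C(x,y) for consecutive parts m_x, m'_y)
pairOK : CInt → CInt → Bool
pairOK (m , x) (m' , y) = (key (m' , y) ≤ᵇ key (m , x)) ∧ ((m' ℕ.+ Cgap x y) ≤ᵇ m)

isC : List CInt → Bool
isC []                 = true
isC (p ∷ [])           = 1 ≤ᵇ val p
isC (p ∷ p' ∷ rest)    = (1 ≤ᵇ val p) ∧ pairOK p p' ∧ isC (p' ∷ rest)

colouredDesc : ℕ → List CInt
colouredDesc zero    = []
colouredDesc (suc m) = (suc m , cd) ∷ (suc m , cc) ∷ (suc m , ca) ∷ colouredDesc m

sublists : {A : Set} → List A → List (List A)
sublists []       = [] ∷ []
sublists (x ∷ xs) = List.map (x ∷_) (sublists xs) ++ sublists xs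

-- the elements of 𝒞 with all parts of value ≤ k.
-- Every λ ∈ 𝒞 is strictly decreasing in the coloured order (C(x,x) ≥ 1),
-- hence is a sublist of colouredDesc k exactly once.
Ck : ℕ → List (List CInt)
Ck k = filter (λ λs → isC λs Data.Bool.≟ true) (sublists (colouredDesc k))
  where import Data.Bool

weight : (q a c d : ℚ) → List CInt → ℚ
weight q a c d []             = 1ℚ
weight q a c d ((m , x) ∷ λs) = q ^ m * colw x * weight q a c d λs
  where
  colw : Colour → ℚ
  colw ca = a
  colw cc = c
  colw cd = d

GC : (k : ℕ) (q a c d : ℚ) → ℚ
GC k q a c d = List.foldr _+_ 0ℚ (List.map (weight q a c d) (Ck k))

-- Both sides are shown to satisfy the same fourth-order linear recurrence in n = k + 1 and to
-- agree for n ≤ 3.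
--
-- Combinatorially, removing the parts of value k + 1 expresses G_(k+1) through G_k, G_(k-1) and
-- the generating function T_k of the sequences with parts ≤ k that may follow the part (k+1)_c;
-- T obeys a similar first-order recurrence, and eliminating it gives the recurrence.
--
-- Analytically, u_j(a,c,c,d) (cq;q)_j = v_j, where v_(j+2) = (1 + a q^(j+1))(1 + d q^(j+1)) v_j
-- + (-1)^j w_(j+2) with w_i = (c;q)_i q^i / (q;q)_i, so the right-hand side is
-- R(n) = Σ_{j+m=n} v_j E_(j+1)(m) with E_k(m) = (c q^k;q)_m q^(m C 2) / (q;q)_m. The q-Pascal rule
-- E_(k+1)(m+1) = E_k(m+1) + c q^(k+m) E_(k+1)(m) and the ratio E_k(m+1) / E_k(m) turn the
-- recurrence of v into one for R. The contributions of the w_i add up to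
-- (c;q)_n Σ_{i+m=n} (-1)^i q^i q^(m C 2) / ((q;q)_i (q;q)_m), which vanishes for n ≥ 2 since the
-- factor 1 - q^(i+m) = (1 - q^m) + q^m (1 - q^i) makes the sum telescope.

module Submission where

open import Defs
open import Data.Nat using (ℕ; suc; _≤_; _≥_)
open import Data.Rational using (ℚ; 1ℚ; _*_)
open import Relation.Binary.PropositionalEquality using (_≡_; _≢_)

open import Data.Nat as ℕ using (zero; z≤n; s≤s; _∸_)
import Data.Nat.Properties as ℕ
open import Data.Nat.Combinatorics using (_C_; nCk+nC[k+1]≡[n+1]C[k+1]; nC1≡n)
open import Data.Rational using (0ℚ; _+_; _-_; -_; ≢-nonZero)
import Data.Rational.Properties as ℚ
open import Data.Bool as Bool using (Bool; true; false; _∧_; if_then_else_)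
open import Data.Bool.Properties using (T-≡; ¬-not; ∧-zeroʳ)
open import Data.Empty using (⊥-elim)
open import Data.List as List using (List; []; _∷_; _++_)
open import Data.List.Relation.Unary.All using (All; []; _∷_)
open import Relation.Nullary.Decidable using (dec⇒maybe)
open import Data.Product using (_×_; _,_)
open import Data.Sum using (inj₁; inj₂)
open import Function.Bundles using (Equivalence)
open import Level using (0ℓ)
open import Relation.Nullary using (yes; no)
open import Relation.Binary.PropositionalEquality using (refl; sym; trans; cong; cong₂; subst)
open Relation.Binary.PropositionalEquality.≡-Reasoning
import Tactic.RingSolver.Core.AlmostCommutativeRing as ACR
open import Tactic.RingSolver using (solve-∀)
open import Data.Nat.Tactic.RingSolver using () renaming (solve-∀ to ℕ-solve-∀)

ℚ-ring : ACR.AlmostCommutativeRing 0ℓ 0ℓ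
ℚ-ring = ACR.fromCommutativeRing ℚ.+-*-commutativeRing (λ x → dec⇒maybe (0ℚ ℚ.≟ x))

inv-inverseʳ : ∀ x → x ≢ 0ℚ → x * inv x ≡ 1ℚ
inv-inverseʳ x x≢0 with x ℚ.≟ 0ℚ
... | yes x≡0 = ⊥-elim (x≢0 x≡0)
... | no  x≢0 = ℚ.*-inverseʳ x {{≢-nonZero x≢0}}

*-cancelˡ : ∀ x {y z} → x ≢ 0ℚ → x * y ≡ x * z → y ≡ z
*-cancelˡ x {y} {z} x≢0 xy≡xz = begin
  y                    ≡⟨ sym (ℚ.*-identityʳ y) ⟩
  y * 1ℚ               ≡⟨ cong (y *_) (sym (inv-inverseʳ x x≢0)) ⟩
  y * (x * inv x)      ≡⟨ shuffle y x (inv x) ⟩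
  (x * y) * inv x      ≡⟨ cong (_* inv x) xy≡xz ⟩
  (x * z) * inv x      ≡⟨ sym (shuffle z x (inv x)) ⟩
  z * (x * inv x)      ≡⟨ cong (z *_) (inv-inverseʳ x x≢0) ⟩
  z * 1ℚ               ≡⟨ ℚ.*-identityʳ z ⟩
  z                    ∎
  where
  shuffle : ∀ y x i → y * (x * i) ≡ (x * y) * i
  shuffle = solve-∀ ℚ-ring

*-≢0 : ∀ {x y} → x ≢ 0ℚ → y ≢ 0ℚ → x * y ≢ 0ℚ
*-≢0 {x} {y} x≢0 y≢0 xy≡0 = y≢0 (*-cancelˡ x x≢0 (trans xy≡0 (sym (ℚ.*-zeroʳ x))))

*-≢0⇒≢0ʳ : ∀ x {y} → x * y ≢ 0ℚ → y ≢ 0ℚ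
*-≢0⇒≢0ʳ x xy≢0 y≡0 = xy≢0 (trans (cong (x *_) y≡0) (ℚ.*-zeroʳ x))

1-x≢0 : ∀ {x} → x ≢ 1ℚ → 1ℚ - x ≢ 0ℚ
1-x≢0 {x} x≢1 1-x≡0 = x≢1 (begin
  x              ≡⟨ double-complement x ⟩
  1ℚ - (1ℚ - x)  ≡⟨ cong (λ t → 1ℚ - t) 1-x≡0 ⟩
  1ℚ             ∎)
  where
  double-complement : ∀ x → x ≡ 1ℚ - (1ℚ - x)
  double-complement = solve-∀ ℚ-ring

inv-* : ∀ {x y} → x ≢ 0ℚ → y ≢ 0ℚ → inv (x * y) ≡ inv x * inv y
inv-* {x} {y} x≢0 y≢0 = sym (*-cancelˡ (x * y) (*-≢0 x≢0 y≢0) (begin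
  (x * y) * (inv x * inv y)  ≡⟨ interchange x y (inv x) (inv y) ⟩
  (x * inv x) * (y * inv y)  ≡⟨ cong₂ _*_ (inv-inverseʳ x x≢0) (inv-inverseʳ y y≢0) ⟩
  1ℚ                         ≡⟨ sym (inv-inverseʳ (x * y) (*-≢0 x≢0 y≢0)) ⟩
  (x * y) * inv (x * y)      ∎))
  where
  interchange : ∀ x y i j → (x * y) * (i * j) ≡ (x * i) * (y * j)
  interchange = solve-∀ ℚ-ring

*-inv-cross : ∀ α β {X Y} → X ≢ 0ℚ → Y ≢ 0ℚ → α * X ≡ β * Y → α * inv Y ≡ β * inv X
*-inv-cross α β {X} {Y} X≢0 Y≢0 αX≡βY = *-cancelˡ (X * Y) (*-≢0 X≢0 Y≢0) (begin
  X * Y * (α * inv Y)        ≡⟨ regroup X Y α (inv Y) ⟩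
  α * X * (Y * inv Y)        ≡⟨ cong₂ _*_ αX≡βY (inv-inverseʳ Y Y≢0) ⟩
  β * Y * 1ℚ                 ≡⟨ cong (β * Y *_) (sym (inv-inverseʳ X X≢0)) ⟩
  β * Y * (X * inv X)        ≡⟨ regroup′ X Y β (inv X) ⟩
  X * Y * (β * inv X)        ∎)
  where
  regroup : ∀ X Y α i → X * Y * (α * i) ≡ α * X * (Y * i)
  regroup = solve-∀ ℚ-ring
  regroup′ : ∀ X Y β i → β * Y * (X * i) ≡ X * Y * (β * i)
  regroup′ = solve-∀ ℚ-ring

^-+ : ∀ x m n → x ^ (m ℕ.+ n) ≡ x ^ m * x ^ n
^-+ x zero    n = sym (ℚ.*-identityˡ (x ^ n))
^-+ x (suc m) n = trans (cong (x *_) (^-+ x m n)) (sym (ℚ.*-assoc x (x ^ m) (x ^ n)))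

^-+-≡ : ∀ x m n {l} → m ℕ.+ n ≡ l → x ^ m * x ^ n ≡ x ^ l
^-+-≡ x m n refl = sym (^-+ x m n)

1^ : ∀ n → 1ℚ ^ n ≡ 1ℚ
1^ zero    = refl
1^ (suc n) = trans (ℚ.*-identityˡ (1ℚ ^ n)) (1^ n)

*-^-suc : ∀ c x i → c * x ^ suc i ≡ c * x ^ i * x
*-^-suc c x i = trans (cong (c *_) (ℚ.*-comm x (x ^ i))) (sym (ℚ.*-assoc c (x ^ i) x))

^2-^ : ∀ x m → (x ^ 2) ^ m ≡ x ^ (2 ℕ.* m)
^2-^ x zero    = refl
^2-^ x (suc m) = begin
  x ^ 2 * (x ^ 2) ^ m      ≡⟨ cong (x ^ 2 *_) (^2-^ x m) ⟩
  x ^ 2 * x ^ (2 ℕ.* m)    ≡⟨ ^-+-≡ x 2 (2 ℕ.* m) (sym (ℕ.*-distribˡ-+ 2 1 m)) ⟩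
  x ^ (2 ℕ.* suc m)        ∎

+≡⇒≤ˡ : ∀ {i m n} → i ℕ.+ m ≡ n → i ≤ n
+≡⇒≤ˡ {i} {m} refl = ℕ.m≤m+n i m

+≡⇒≤ʳ : ∀ {i m n} → i ℕ.+ m ≡ n → m ≤ n
+≡⇒≤ʳ {i} {m} refl = ℕ.m≤n+m m i

Σ<-cong : ∀ n {f g : ℕ → ℚ} → (∀ i → i ℕ.< n → f i ≡ g i) → Σ< n f ≡ Σ< n g
Σ<-cong zero    f≗g = refl
Σ<-cong (suc n) f≗g = cong₂ _+_ (Σ<-cong n (λ i i<n → f≗g i (ℕ.m<n⇒m<1+n i<n))) (f≗g n ℕ.≤-refl)

*-distribˡ-Σ< : ∀ n x f → x * Σ< n f ≡ Σ< n (λ i → x * f i)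
*-distribˡ-Σ< zero    x f = ℚ.*-zeroʳ x
*-distribˡ-Σ< (suc n) x f =
  trans (ℚ.*-distribˡ-+ x (Σ< n f) (f n)) (cong (_+ x * f n) (*-distribˡ-Σ< n x f))

-- Σ+ n F is the sum of F j m over the antidiagonal j + m = n.
Σ+ : ℕ → (ℕ → ℕ → ℚ) → ℚ
Σ+ zero    F = F 0 0
Σ+ (suc n) F = F 0 (suc n) + Σ+ n (λ j m → F (suc j) m)

Σ+-cong : ∀ n {F G} → (∀ j m → j ℕ.+ m ≡ n → F j m ≡ G j m) → Σ+ n F ≡ Σ+ n G
Σ+-cong zero    F≗G = F≗G 0 0 refl
Σ+-cong (suc n) F≗G = cong₂ _+_ (F≗G 0 (suc n) refl) (Σ+-cong n (λ j m e → F≗G (suc j) m (cong suc e)))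

Σ+-+ : ∀ n F G → Σ+ n (λ j m → F j m + G j m) ≡ Σ+ n F + Σ+ n G
Σ+-+ zero    F G = refl
Σ+-+ (suc n) F G = begin
  (F 0 (suc n) + G 0 (suc n)) + Σ+ n (λ j m → F (suc j) m + G (suc j) m)
    ≡⟨ cong ((F 0 (suc n) + G 0 (suc n)) +_) (Σ+-+ n (λ j m → F (suc j) m) (λ j m → G (suc j) m)) ⟩
  (F 0 (suc n) + G 0 (suc n)) + (Σ+ n (λ j m → F (suc j) m) + Σ+ n (λ j m → G (suc j) m))
    ≡⟨ interchange (F 0 (suc n)) (G 0 (suc n)) (Σ+ n (λ j m → F (suc j) m)) (Σ+ n (λ j m → G (suc j) m)) ⟩
  Σ+ (suc n) F + Σ+ (suc n) G ∎
  where
  interchange : ∀ a b c d → (a + b) + (c + d) ≡ (a + c) + (b + d)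
  interchange = solve-∀ ℚ-ring

*-distribˡ-Σ+ : ∀ n x F → x * Σ+ n F ≡ Σ+ n (λ j m → x * F j m)
*-distribˡ-Σ+ zero    x F = refl
*-distribˡ-Σ+ (suc n) x F =
  trans (ℚ.*-distribˡ-+ x (F 0 (suc n)) _) (cong (x * F 0 (suc n) +_) (*-distribˡ-Σ+ n x (λ j m → F (suc j) m)))

Σ+-suc : ∀ n F → Σ+ (suc n) F ≡ Σ+ n (λ j m → F j (suc m)) + F (suc n) 0
Σ+-suc zero    F = refl
Σ+-suc (suc n) F = begin
  F 0 (suc (suc n)) + Σ+ (suc n) (λ j m → F (suc j) m)
    ≡⟨ cong (F 0 (suc (suc n)) +_) (Σ+-suc n (λ j m → F (suc j) m)) ⟩
  F 0 (suc (suc n)) + (Σ+ n (λ j m → F (suc j) (suc m)) + F (suc (suc n)) 0)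
    ≡⟨ sym (ℚ.+-assoc (F 0 (suc (suc n))) _ _) ⟩
  Σ+ (suc n) (λ j m → F j (suc m)) + F (suc (suc n)) 0 ∎

Σ<-as-Σ+ : ∀ n f F → (∀ j m → j ℕ.+ m ≡ n → f j ≡ F j m) → Σ< (suc n) f ≡ Σ+ n F
Σ<-as-Σ+ zero    f F f≗F = trans (ℚ.+-identityˡ (f 0)) (f≗F 0 0 refl)
Σ<-as-Σ+ (suc n) f F f≗F = begin
  Σ< (suc n) f + f (suc n)
    ≡⟨ cong₂ _+_ (Σ<-as-Σ+ n f (λ j m → F j (suc m)) (λ j m e → f≗F j (suc m) (trans (ℕ.+-suc j m) (cong suc e))))
                 (f≗F (suc n) 0 (ℕ.+-identityʳ (suc n))) ⟩
  Σ+ n (λ j m → F j (suc m)) + F (suc n) 0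
    ≡⟨ sym (Σ+-suc n F) ⟩
  Σ+ (suc n) F ∎

poch-suc : ∀ x p m → poch x p (suc m) ≡ (1ℚ - x) * poch (x * p) p m
poch-suc x p zero    = base x
  where
  base : ∀ x → 1ℚ * (1ℚ - x * 1ℚ) ≡ (1ℚ - x) * 1ℚ
  base = solve-∀ ℚ-ring
poch-suc x p (suc m) = begin
  poch x p (suc m) * (1ℚ - x * (p * p ^ m))
    ≡⟨ cong (_* (1ℚ - x * (p * p ^ m))) (poch-suc x p m) ⟩
  (1ℚ - x) * poch (x * p) p m * (1ℚ - x * (p * p ^ m))
    ≡⟨ reassoc x p (poch (x * p) p m) (p ^ m) ⟩
  (1ℚ - x) * poch (x * p) p (suc m) ∎
  where
  reassoc : ∀ x p P r → (1ℚ - x) * P * (1ℚ - x * (p * r)) ≡ (1ℚ - x) * (P * (1ℚ - x * p * r))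
  reassoc = solve-∀ ℚ-ring

poch-+ : ∀ x p m n → poch x p (m ℕ.+ n) ≡ poch x p m * poch (x * p ^ m) p n
poch-+ x p m zero    = trans (cong (poch x p) (ℕ.+-identityʳ m)) (sym (ℚ.*-identityʳ _))
poch-+ x p m (suc n) = begin
  poch x p (m ℕ.+ suc n)
    ≡⟨ cong (poch x p) (ℕ.+-suc m n) ⟩
  poch x p (m ℕ.+ n) * (1ℚ - x * p ^ (m ℕ.+ n))
    ≡⟨ cong₂ (λ P s → P * (1ℚ - x * s)) (poch-+ x p m n) (^-+ p m n) ⟩
  poch x p m * poch (x * p ^ m) p n * (1ℚ - x * (p ^ m * p ^ n))
    ≡⟨ reassoc x (poch x p m) (poch (x * p ^ m) p n) (p ^ m) (p ^ n) ⟩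
  poch x p m * poch (x * p ^ m) p (suc n) ∎
  where
  reassoc : ∀ x A B s t → A * B * (1ℚ - x * (s * t)) ≡ A * (B * (1ℚ - x * s * t))
  reassoc = solve-∀ ℚ-ring

poch-≢0 : ∀ x p M → (∀ i → i ℕ.< M → x * p ^ i ≢ 1ℚ) → poch x p M ≢ 0ℚ
poch-≢0 x p zero    _     ()
poch-≢0 x p (suc M) xpⁱ≢1 =
  *-≢0 (poch-≢0 x p M (λ i i<M → xpⁱ≢1 i (ℕ.m<n⇒m<1+n i<M))) (1-x≢0 (xpⁱ≢1 M ℕ.≤-refl))

poch-odd : ∀ x q m → poch x q (suc (2 ℕ.* m)) ≡ poch x (q ^ 2) (suc m) * poch (x * q) (q ^ 2) m
poch-odd x q zero    = sym (ℚ.*-identityʳ _)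
poch-odd x q (suc m) = begin
  poch x q (suc (2 ℕ.* suc m))
    ≡⟨ cong (λ t → poch x q (suc t)) (ℕ.*-suc 2 m) ⟩
  poch x q (suc (2 ℕ.* m)) * (1ℚ - x * (q * T)) * (1ℚ - x * (q * (q * T)))
    ≡⟨ cong (λ P → P * (1ℚ - x * (q * T)) * (1ℚ - x * (q * (q * T)))) (poch-odd x q m) ⟩
  Pe * Po * (1ℚ - x * (q * T)) * (1ℚ - x * (q * (q * T)))
    ≡⟨ regroup Pe Po x q T ⟩
  Pe * (1ℚ - x * ((q * (q * 1ℚ)) * T)) * (Po * (1ℚ - (x * q) * T))
    ≡⟨ cong (λ t → Pe * (1ℚ - x * ((q ^ 2) * t)) * (Po * (1ℚ - (x * q) * t))) (sym (^2-^ q m)) ⟩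
  poch x (q ^ 2) (suc (suc m)) * poch (x * q) (q ^ 2) (suc m) ∎
  where
  T  = q ^ (2 ℕ.* m)
  Pe = poch x (q ^ 2) (suc m)
  Po = poch (x * q) (q ^ 2) m
  regroup : ∀ Pe Po x q T → Pe * Po * (1ℚ - x * (q * T)) * (1ℚ - x * (q * (q * T)))
                          ≡ Pe * (1ℚ - x * ((q * (q * 1ℚ)) * T)) * (Po * (1ℚ - (x * q) * T))
  regroup = solve-∀ ℚ-ring

C2-suc : ∀ m → suc m C 2 ≡ m C 2 ℕ.+ m
C2-suc m = begin
  suc m C 2        ≡⟨ sym (nCk+nC[k+1]≡[n+1]C[k+1] m 1) ⟩
  m C 1 ℕ.+ m C 2  ≡⟨ cong (ℕ._+ m C 2) (nC1≡n m) ⟩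
  m ℕ.+ m C 2      ≡⟨ ℕ.+-comm m (m C 2) ⟩
  m C 2 ℕ.+ m      ∎

module QFactorial (q : ℚ) where

  ι : ℕ → ℚ
  ι m = inv (poch q q m)

  ε : ℕ → ℚ
  ε m = q ^ (m C 2) ÷ poch q q m

  F : ℚ → ℕ → ℚ
  F x m = poch x q m * ε m

  sgn : ℕ → ℚ
  sgn zero    = 1ℚ
  sgn (suc i) = - sgn i

  alternating : ℚ → ℕ → ℚ
  alternating s n = Σ+ n (λ i m → s ^ i * (sgn i * ι i) * ε m)

  module _ {N : ℕ} (q^i≢1 : ∀ i → 1 ≤ i → i ≤ N → q ^ i ≢ 1ℚ) where

    1-q^suc≢0 : ∀ {m} → suc m ≤ N → 1ℚ - q ^ suc m ≢ 0ℚ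
    1-q^suc≢0 {m} le = 1-x≢0 (q^i≢1 (suc m) (s≤s z≤n) le)

    poch-q≢0 : ∀ {m} → m ≤ N → poch q q m ≢ 0ℚ
    poch-q≢0 {m} le = poch-≢0 q q m (λ i i<m → q^i≢1 (suc i) (s≤s z≤n) (ℕ.≤-trans i<m le))

    ι-suc : ∀ {m} → suc m ≤ N → ι (suc m) * (1ℚ - q ^ suc m) ≡ ι m
    ι-suc {m} le = begin
      inv (poch q q m * r) * r      ≡⟨ cong (_* r) (inv-* P≢0 r≢0) ⟩
      inv (poch q q m) * inv r * r  ≡⟨ ℚ.*-assoc (ι m) (inv r) r ⟩
      ι m * (inv r * r)             ≡⟨ cong (ι m *_) (trans (ℚ.*-comm (inv r) r) (inv-inverseʳ r r≢0)) ⟩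
      ι m * 1ℚ                      ≡⟨ ℚ.*-identityʳ (ι m) ⟩
      ι m                           ∎
      where
      r   = 1ℚ - q ^ suc m
      r≢0 = 1-q^suc≢0 le
      P≢0 = poch-q≢0 (ℕ.≤-trans (ℕ.n≤1+n m) le)

    ε-suc : ∀ {m} → suc m ≤ N → ε (suc m) * (1ℚ - q ^ suc m) ≡ q ^ m * ε m
    ε-suc {m} le = begin
      q ^ (suc m C 2) * ι (suc m) * (1ℚ - q ^ suc m)
        ≡⟨ cong (λ e → q ^ e * ι (suc m) * (1ℚ - q ^ suc m)) (C2-suc m) ⟩
      q ^ (m C 2 ℕ.+ m) * ι (suc m) * (1ℚ - q ^ suc m)
        ≡⟨ cong (λ t → t * ι (suc m) * (1ℚ - q ^ suc m)) (^-+ q (m C 2) m) ⟩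
      q ^ (m C 2) * q ^ m * ι (suc m) * (1ℚ - q ^ suc m)
        ≡⟨ regroup (q ^ (m C 2)) (q ^ m) (ι (suc m)) (1ℚ - q ^ suc m) ⟩
      q ^ m * (q ^ (m C 2) * (ι (suc m) * (1ℚ - q ^ suc m)))
        ≡⟨ cong (λ t → q ^ m * (q ^ (m C 2) * t)) (ι-suc le) ⟩
      q ^ m * ε m ∎
      where
      regroup : ∀ x y i r → x * y * i * r ≡ y * (x * (i * r))
      regroup = solve-∀ ℚ-ring

    -- Split 1 - q^(i+m) = (1 - q^m) + q^m (1 - q^i): the two parts telescope in i and in m.
    alternating-suc : ∀ s {n} → suc n ≤ N →
      (1ℚ - q ^ suc n) * alternating s (suc n) ≡ (1ℚ - s) * Σ+ n (λ i m → s ^ i * (sgn i * ι i) * (q ^ m * ε m))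
    alternating-suc s {n} le = begin
      (1ℚ - q ^ suc n) * alternating s (suc n)
        ≡⟨ *-distribˡ-Σ+ (suc n) (1ℚ - q ^ suc n) (λ i m → s ^ i * α i * ε m) ⟩
      Σ+ (suc n) (λ i m → (1ℚ - q ^ suc n) * (s ^ i * α i * ε m))
        ≡⟨ Σ+-cong (suc n) split ⟩
      Σ+ (suc n) (λ i m → F₁ i m + F₂ i m)
        ≡⟨ Σ+-+ (suc n) F₁ F₂ ⟩
      Σ+ (suc n) F₁ + Σ+ (suc n) F₂
        ≡⟨ cong (_+ Σ+ (suc n) F₂) (Σ+-suc n F₁) ⟩
      Σ+ n (λ i m → F₁ i (suc m)) + F₁ (suc n) 0 + (F₂ 0 (suc n) + Σ+ n (λ i m → F₂ (suc i) m))
        ≡⟨ cong₂ (λ x y → x + F₁ (suc n) 0 + (F₂ 0 (suc n) + y))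
             (Σ+-cong n (λ i m e → cong (s ^ i * α i *_) (ε-suc {m} (ℕ.≤-trans (s≤s (+≡⇒≤ʳ e)) le))))
             (Σ+-cong n (λ i m e → trans (cong (s ^ suc i * (q ^ m * ε m) *_) (α-suc {i} (ℕ.≤-trans (s≤s (+≡⇒≤ˡ e)) le)))
                                         (shift-sign s (s ^ i) (α i) (q ^ m * ε m)))) ⟩
      X + F₁ (suc n) 0 + (F₂ 0 (suc n) + Σ+ n (λ i m → - s * (s ^ i * α i * (q ^ m * ε m))))
        ≡⟨ cong (λ y → X + F₁ (suc n) 0 + (F₂ 0 (suc n) + y)) (sym (*-distribˡ-Σ+ n (- s) (λ i m → s ^ i * α i * (q ^ m * ε m)))) ⟩
      X + s ^ suc n * α (suc n) * 0ℚ + (s ^ 0 * (q ^ suc n * ε (suc n)) * 0ℚ + - s * X)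
        ≡⟨ collect X (s ^ suc n * α (suc n)) (s ^ 0 * (q ^ suc n * ε (suc n))) s ⟩
      (1ℚ - s) * X ∎
      where
      α : ℕ → ℚ
      α i = sgn i * ι i
      X = Σ+ n (λ i m → s ^ i * α i * (q ^ m * ε m))
      F₁ F₂ : ℕ → ℕ → ℚ
      F₁ i m = s ^ i * α i * (ε m * (1ℚ - q ^ m))
      F₂ i m = s ^ i * (q ^ m * ε m) * (α i * (1ℚ - q ^ i))
      α-suc : ∀ {i} → suc i ≤ N → α (suc i) * (1ℚ - q ^ suc i) ≡ - α i
      α-suc {i} le = trans (ℚ.*-assoc (- sgn i) (ι (suc i)) _) (trans (cong (- sgn i *_) (ι-suc le)) (sym (ℚ.neg-distribˡ-* (sgn i) (ι i))))
      split : ∀ i m → i ℕ.+ m ≡ suc n → (1ℚ - q ^ suc n) * (s ^ i * α i * ε m) ≡ F₁ i m + F₂ i m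
      split i m e = begin
        (1ℚ - q ^ suc n) * (s ^ i * α i * ε m)       ≡⟨ cong (λ t → (1ℚ - t) * (s ^ i * α i * ε m)) (sym (^-+-≡ q i m e)) ⟩
        (1ℚ - q ^ i * q ^ m) * (s ^ i * α i * ε m)   ≡⟨ distribute (q ^ i) (q ^ m) (s ^ i) (α i) (ε m) ⟩
        _ ∎
        where
        distribute : ∀ x y t a e → (1ℚ - x * y) * (t * a * e) ≡ t * a * (e * (1ℚ - y)) + t * (y * e) * (a * (1ℚ - x))
        distribute = solve-∀ ℚ-ring
      shift-sign : ∀ s t a y → s * t * y * (- a) ≡ - s * (t * a * y)
      shift-sign = solve-∀ ℚ-ring
      collect : ∀ X a b s → X + a * 0ℚ + (b * 0ℚ + - s * X) ≡ (1ℚ - s) * X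
      collect = solve-∀ ℚ-ring

    alternating-1ℚ : ∀ {n} → suc n ≤ N → alternating 1ℚ (suc n) ≡ 0ℚ
    alternating-1ℚ {n} le = *-cancelˡ (1ℚ - q ^ suc n) (1-q^suc≢0 le) (begin
      (1ℚ - q ^ suc n) * alternating 1ℚ (suc n)  ≡⟨ alternating-suc 1ℚ le ⟩
      (1ℚ - 1ℚ) * X                              ≡⟨ ℚ.*-zeroˡ X ⟩
      0ℚ                                         ≡⟨ sym (ℚ.*-zeroʳ (1ℚ - q ^ suc n)) ⟩
      (1ℚ - q ^ suc n) * 0ℚ                      ∎)
      where X = Σ+ n (λ i m → 1ℚ ^ i * (sgn i * ι i) * (q ^ m * ε m))

    alternating-q-1 : 1 ≤ N → alternating q 1 ≡ 1ℚ
    alternating-q-1 le = *-cancelˡ (1ℚ - q ^ 1) (1-q^suc≢0 le) (begin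
      (1ℚ - q ^ 1) * alternating q 1  ≡⟨ alternating-suc q le ⟩
      (1ℚ - q) * 1ℚ                   ≡⟨ cong (λ t → (1ℚ - t) * 1ℚ) (sym (ℚ.*-identityʳ q)) ⟩
      (1ℚ - q ^ 1) * 1ℚ               ∎)

    alternating-q : ∀ {n} → suc (suc n) ≤ N → alternating q (suc (suc n)) ≡ 0ℚ
    alternating-q {n} le = *-cancelˡ (1ℚ - q ^ suc (suc n)) (1-q^suc≢0 le) (begin
      (1ℚ - q ^ suc (suc n)) * alternating q (suc (suc n))
        ≡⟨ alternating-suc q le ⟩
      (1ℚ - q) * Σ+ (suc n) (λ i m → q ^ i * (sgn i * ι i) * (q ^ m * ε m))
        ≡⟨ cong ((1ℚ - q) *_) (Σ+-cong (suc n) pull-out) ⟩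
      (1ℚ - q) * Σ+ (suc n) (λ i m → q ^ suc n * (1ℚ ^ i * (sgn i * ι i) * ε m))
        ≡⟨ cong ((1ℚ - q) *_) (sym (*-distribˡ-Σ+ (suc n) (q ^ suc n) (λ i m → 1ℚ ^ i * (sgn i * ι i) * ε m))) ⟩
      (1ℚ - q) * (q ^ suc n * alternating 1ℚ (suc n))
        ≡⟨ cong (λ t → (1ℚ - q) * (q ^ suc n * t)) (alternating-1ℚ (ℕ.≤-trans (ℕ.n≤1+n _) le)) ⟩
      (1ℚ - q) * (q ^ suc n * 0ℚ)
        ≡⟨ vanish (1ℚ - q) (q ^ suc n) (1ℚ - q ^ suc (suc n)) ⟩
      (1ℚ - q ^ suc (suc n)) * 0ℚ ∎)
      where
      pull-out : ∀ i m → i ℕ.+ m ≡ suc n →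
        q ^ i * (sgn i * ι i) * (q ^ m * ε m) ≡ q ^ suc n * (1ℚ ^ i * (sgn i * ι i) * ε m)
      pull-out i m e = begin
        q ^ i * (sgn i * ι i) * (q ^ m * ε m)       ≡⟨ regroup (q ^ i) (q ^ m) (sgn i * ι i) (ε m) ⟩
        q ^ i * q ^ m * (1ℚ * (sgn i * ι i) * ε m)  ≡⟨ cong₂ (λ x o → x * (o * (sgn i * ι i) * ε m)) (^-+-≡ q i m e) (sym (1^ i)) ⟩
        q ^ suc n * (1ℚ ^ i * (sgn i * ι i) * ε m)  ∎
        where
        regroup : ∀ x y a e → x * a * (y * e) ≡ x * y * (1ℚ * a * e)
        regroup = solve-∀ ℚ-ring
      vanish : ∀ a b c → a * (b * 0ℚ) ≡ c * 0ℚ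
      vanish = solve-∀ ℚ-ring

    F-suc : ∀ x {m} → suc m ≤ N → F x (suc m) * (1ℚ - q ^ suc m) ≡ q ^ m * (1ℚ - x * q ^ m) * F x m
    F-suc x {m} le = begin
      poch x q m * (1ℚ - x * q ^ m) * ε (suc m) * (1ℚ - q ^ suc m)
        ≡⟨ ℚ.*-assoc (poch x q m * (1ℚ - x * q ^ m)) (ε (suc m)) (1ℚ - q ^ suc m) ⟩
      poch x q m * (1ℚ - x * q ^ m) * (ε (suc m) * (1ℚ - q ^ suc m))
        ≡⟨ cong (poch x q m * (1ℚ - x * q ^ m) *_) (ε-suc le) ⟩
      poch x q m * (1ℚ - x * q ^ m) * (q ^ m * ε m)
        ≡⟨ regroup (poch x q m) (1ℚ - x * q ^ m) (q ^ m) (ε m) ⟩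
      q ^ m * (1ℚ - x * q ^ m) * F x m ∎
      where
      regroup : ∀ P y t e → P * y * (t * e) ≡ t * y * (P * e)
      regroup = solve-∀ ℚ-ring

    F-pascal : ∀ x {m} → suc m ≤ N → F (x * q) (suc m) ≡ F x (suc m) + x * q ^ m * F (x * q) m
    F-pascal x {m} le = begin
      P * (1ℚ - x * q * q ^ m) * ε (suc m)
        ≡⟨ distribute P x q (q ^ m) (ε (suc m)) ⟩
      (1ℚ - x) * P * ε (suc m) + x * P * (ε (suc m) * (1ℚ - q * q ^ m))
        ≡⟨ cong₂ (λ a b → a * ε (suc m) + x * P * b) (sym (poch-suc x q m)) (ε-suc le) ⟩
      F x (suc m) + x * P * (q ^ m * ε m)
        ≡⟨ cong (F x (suc m) +_) (regroup x P (q ^ m) (ε m)) ⟩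
      F x (suc m) + x * q ^ m * F (x * q) m ∎
      where
      P = poch (x * q) q m
      distribute : ∀ P x q t e → P * (1ℚ - x * q * t) * e ≡ (1ℚ - x) * P * e + x * P * (e * (1ℚ - q * t))
      distribute = solve-∀ ℚ-ring
      regroup : ∀ x P t e → x * P * (t * e) ≡ x * t * (P * e)
      regroup = solve-∀ ℚ-ring

module Expansion (q c : ℚ) where
  open QFactorial q

  E : ℕ → ℕ → ℚ
  E k m = F (c * q ^ k) m

  S : ℕ → (ℕ → ℚ) → ℕ → ℚ
  S s φ n = Σ+ n (λ j m → φ j * E (s ℕ.+ j) m)

  S-cong : ∀ s {φ ψ} n → (∀ j → j ≤ n → φ j ≡ ψ j) → S s φ n ≡ S s ψ n
  S-cong s n φ≗ψ = Σ+-cong n (λ j m e → cong (_* E (s ℕ.+ j) m) (φ≗ψ j (+≡⇒≤ˡ e)))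

  S-+ : ∀ s φ ψ n → S s (λ j → φ j + ψ j) n ≡ S s φ n + S s ψ n
  S-+ s φ ψ n = trans (Σ+-cong n (λ j m _ → ℚ.*-distribʳ-+ (E (s ℕ.+ j) m) (φ j) (ψ j)))
                      (Σ+-+ n (λ j m → φ j * E (s ℕ.+ j) m) (λ j m → ψ j * E (s ℕ.+ j) m))

  *-distribˡ-S : ∀ s x φ n → x * S s φ n ≡ S s (λ j → x * φ j) n
  *-distribˡ-S s x φ n = trans (*-distribˡ-Σ+ n x (λ j m → φ j * E (s ℕ.+ j) m))
                               (Σ+-cong n (λ j m _ → sym (ℚ.*-assoc x (φ j) (E (s ℕ.+ j) m))))

  module _ {N : ℕ} (q^i≢1 : ∀ i → 1 ≤ i → i ≤ N → q ^ i ≢ 1ℚ) where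

    E-pascal : ∀ k {m} → suc m ≤ N → E (suc k) (suc m) ≡ E k (suc m) + c * q ^ (k ℕ.+ m) * E (suc k) m
    E-pascal k {m} le = begin
      F (c * q ^ suc k) (suc m)
        ≡⟨ cong (λ x → F x (suc m)) (*-^-suc c q k) ⟩
      F (c * q ^ k * q) (suc m)
        ≡⟨ F-pascal q^i≢1 (c * q ^ k) le ⟩
      E k (suc m) + c * q ^ k * q ^ m * F (c * q ^ k * q) m
        ≡⟨ cong₂ (λ y x → E k (suc m) + y * F x m) (trans (ℚ.*-assoc c (q ^ k) (q ^ m)) (cong (c *_) (^-+-≡ q k m refl))) (sym (*-^-suc c q k)) ⟩
      E k (suc m) + c * q ^ (k ℕ.+ m) * E (suc k) m ∎

    E-suc : ∀ k {m} → suc m ≤ N → E k (suc m) * (1ℚ - q ^ suc m) ≡ q ^ m * (1ℚ - c * q ^ (k ℕ.+ m)) * E k m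
    E-suc k {m} le = trans (F-suc q^i≢1 (c * q ^ k) le)
      (cong (λ y → q ^ m * (1ℚ - y) * E k m) (trans (ℚ.*-assoc c (q ^ k) (q ^ m)) (cong (c *_) (^-+-≡ q k m refl))))

    S-pascal : ∀ s φ {n} → suc n ≤ N → S (suc s) φ (suc n) ≡ S s φ (suc n) + c * q ^ (s ℕ.+ n) * S (suc s) φ n
    S-pascal s φ {n} le = begin
      S (suc s) φ (suc n)
        ≡⟨ Σ+-suc n (λ j m → φ j * E (suc s ℕ.+ j) m) ⟩
      Σ+ n (λ j m → φ j * E (suc (s ℕ.+ j)) (suc m)) + last
        ≡⟨ cong (_+ last) (Σ+-cong n pointwise) ⟩
      Σ+ n (λ j m → φ j * E (s ℕ.+ j) (suc m) + x * (φ j * E (suc s ℕ.+ j) m)) + last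
        ≡⟨ cong (_+ last) (Σ+-+ n (λ j m → φ j * E (s ℕ.+ j) (suc m)) (λ j m → x * (φ j * E (suc s ℕ.+ j) m))) ⟩
      Σ+ n (λ j m → φ j * E (s ℕ.+ j) (suc m)) + Σ+ n (λ j m → x * (φ j * E (suc s ℕ.+ j) m)) + last
        ≡⟨ cong (λ t → Σ+ n (λ j m → φ j * E (s ℕ.+ j) (suc m)) + t + last) (sym (*-distribˡ-Σ+ n x (λ j m → φ j * E (suc s ℕ.+ j) m))) ⟩
      Σ+ n (λ j m → φ j * E (s ℕ.+ j) (suc m)) + x * S (suc s) φ n + last
        ≡⟨ swap (Σ+ n (λ j m → φ j * E (s ℕ.+ j) (suc m))) (x * S (suc s) φ n) last ⟩
      Σ+ n (λ j m → φ j * E (s ℕ.+ j) (suc m)) + last + x * S (suc s) φ n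
        ≡⟨ cong (_+ x * S (suc s) φ n) (sym (Σ+-suc n (λ j m → φ j * E (s ℕ.+ j) m))) ⟩
      S s φ (suc n) + x * S (suc s) φ n ∎
      where
      x    = c * q ^ (s ℕ.+ n)
      last = φ (suc n) * E (s ℕ.+ suc n) 0
      pointwise : ∀ j m → j ℕ.+ m ≡ n →
        φ j * E (suc (s ℕ.+ j)) (suc m) ≡ φ j * E (s ℕ.+ j) (suc m) + x * (φ j * E (suc s ℕ.+ j) m)
      pointwise j m e = begin
        φ j * E (suc (s ℕ.+ j)) (suc m)
          ≡⟨ cong (φ j *_) (E-pascal (s ℕ.+ j) {m} (ℕ.≤-trans (s≤s (+≡⇒≤ʳ e)) le)) ⟩
        φ j * (E (s ℕ.+ j) (suc m) + c * q ^ (s ℕ.+ j ℕ.+ m) * E (suc s ℕ.+ j) m)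
          ≡⟨ cong (λ i → φ j * (E (s ℕ.+ j) (suc m) + c * q ^ i * E (suc s ℕ.+ j) m)) (trans (ℕ.+-assoc s j m) (cong (s ℕ.+_) e)) ⟩
        φ j * (E (s ℕ.+ j) (suc m) + x * E (suc s ℕ.+ j) m)
          ≡⟨ distribute (φ j) (E (s ℕ.+ j) (suc m)) x (E (suc s ℕ.+ j) m) ⟩
        φ j * E (s ℕ.+ j) (suc m) + x * (φ j * E (suc s ℕ.+ j) m) ∎
        where
        distribute : ∀ a b x e → a * (b + x * e) ≡ a * b + x * (a * e)
        distribute = solve-∀ ℚ-ring
      swap : ∀ a b c → a + b + c ≡ a + c + b
      swap = solve-∀ ℚ-ring

    S-qshift : ∀ s φ {n} → suc n ≤ N →
      S s (λ j → q ^ j * φ j) (suc n) ≡ q ^ suc n * S s φ (suc n) + q ^ n * (1ℚ - c * q ^ (s ℕ.+ n)) * S s φ n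
    S-qshift s φ {n} le = begin
      S s (λ j → q ^ j * φ j) (suc n)
        ≡⟨ Σ+-suc n (λ j m → q ^ j * φ j * E (s ℕ.+ j) m) ⟩
      Σ+ n (λ j m → q ^ j * φ j * E (s ℕ.+ j) (suc m)) + q ^ suc n * φ (suc n) * e₀
        ≡⟨ cong (_+ q ^ suc n * φ (suc n) * e₀) (Σ+-cong n pointwise) ⟩
      Σ+ n (λ j m → q ^ suc n * (φ j * E (s ℕ.+ j) (suc m)) + y * (φ j * E (s ℕ.+ j) m)) + q ^ suc n * φ (suc n) * e₀
        ≡⟨ cong (_+ q ^ suc n * φ (suc n) * e₀) (Σ+-+ n (λ j m → q ^ suc n * (φ j * E (s ℕ.+ j) (suc m))) (λ j m → y * (φ j * E (s ℕ.+ j) m))) ⟩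
      Σ+ n (λ j m → q ^ suc n * (φ j * E (s ℕ.+ j) (suc m))) + Σ+ n (λ j m → y * (φ j * E (s ℕ.+ j) m)) + q ^ suc n * φ (suc n) * e₀
        ≡⟨ cong₂ (λ a b → a + b + q ^ suc n * φ (suc n) * e₀) (sym (*-distribˡ-Σ+ n (q ^ suc n) (λ j m → φ j * E (s ℕ.+ j) (suc m))))
                                                       (sym (*-distribˡ-Σ+ n y (λ j m → φ j * E (s ℕ.+ j) m))) ⟩
      q ^ suc n * Σ+ n (λ j m → φ j * E (s ℕ.+ j) (suc m)) + y * S s φ n + q ^ suc n * φ (suc n) * e₀
        ≡⟨ collect (q ^ suc n) _ (y * S s φ n) (φ (suc n)) e₀ ⟩
      q ^ suc n * (Σ+ n (λ j m → φ j * E (s ℕ.+ j) (suc m)) + φ (suc n) * e₀) + y * S s φ n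
        ≡⟨ cong (λ t → q ^ suc n * t + y * S s φ n) (sym (Σ+-suc n (λ j m → φ j * E (s ℕ.+ j) m))) ⟩
      q ^ suc n * S s φ (suc n) + y * S s φ n ∎
      where
      y    = q ^ n * (1ℚ - c * q ^ (s ℕ.+ n))
      e₀   = E (s ℕ.+ suc n) 0
      -- q^j = q^(j+m+1) + q^j (1 - q^(m+1)), and the second part lowers m by E-suc.
      pointwise : ∀ j m → j ℕ.+ m ≡ n →
        q ^ j * φ j * E (s ℕ.+ j) (suc m) ≡ q ^ suc n * (φ j * E (s ℕ.+ j) (suc m)) + y * (φ j * E (s ℕ.+ j) m)
      pointwise j m e = begin
        q ^ j * φ j * E (s ℕ.+ j) (suc m)
          ≡⟨ split (q ^ j) (q ^ suc m) (φ j) (E (s ℕ.+ j) (suc m)) ⟩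
        q ^ j * q ^ suc m * (φ j * E (s ℕ.+ j) (suc m)) + q ^ j * φ j * (E (s ℕ.+ j) (suc m) * (1ℚ - q ^ suc m))
          ≡⟨ cong₂ (λ a b → a * (φ j * E (s ℕ.+ j) (suc m)) + q ^ j * φ j * b)
               (^-+-≡ q j (suc m) (trans (ℕ.+-suc j m) (cong suc e)))
               (E-suc (s ℕ.+ j) {m} (ℕ.≤-trans (s≤s (+≡⇒≤ʳ e)) le)) ⟩
        q ^ suc n * (φ j * E (s ℕ.+ j) (suc m)) + q ^ j * φ j * (q ^ m * (1ℚ - c * q ^ (s ℕ.+ j ℕ.+ m)) * E (s ℕ.+ j) m)
          ≡⟨ cong (q ^ suc n * (φ j * E (s ℕ.+ j) (suc m)) +_) (regroup (q ^ j) (q ^ m) (φ j) (1ℚ - c * q ^ (s ℕ.+ j ℕ.+ m)) (E (s ℕ.+ j) m)) ⟩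
        q ^ suc n * (φ j * E (s ℕ.+ j) (suc m)) + q ^ j * q ^ m * (1ℚ - c * q ^ (s ℕ.+ j ℕ.+ m)) * (φ j * E (s ℕ.+ j) m)
          ≡⟨ cong₂ (λ a i → q ^ suc n * (φ j * E (s ℕ.+ j) (suc m)) + a * (1ℚ - c * q ^ i) * (φ j * E (s ℕ.+ j) m))
               (^-+-≡ q j m e) (trans (ℕ.+-assoc s j m) (cong (s ℕ.+_) e)) ⟩
        q ^ suc n * (φ j * E (s ℕ.+ j) (suc m)) + y * (φ j * E (s ℕ.+ j) m) ∎
        where
        split : ∀ x t a e → x * a * e ≡ x * t * (a * e) + x * a * (e * (1ℚ - t))
        split = solve-∀ ℚ-ring
        regroup : ∀ x t a r e → x * a * (t * r * e) ≡ x * t * r * (a * e)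
        regroup = solve-∀ ℚ-ring
      collect : ∀ x a b p e → x * a + b + x * p * e ≡ x * (a + p * e) + b
      collect = solve-∀ ℚ-ring

-- t₁, z₂, t₂, z₃, z₄ follow the coupled recurrences T-suc and z-suc of the combinatorial side
-- (with x = q^n); eliminating t yields the recurrence Recurrence.step.
coupled-identity : ∀ (q a c d x z₀ z₁ t₀ : ℚ) →
  let x₁ = q * x
      x₂ = q * x₁
      x₃ = q * x₂
      t₁ = c * x₁ * t₀ + a * x₁ * z₀ + z₁
      z₂ = z₁ + a * x₁ * (1ℚ + d * x₁) * z₀ + (c + d) * x₁ * t₀
      t₂ = c * x₂ * t₁ + a * x₂ * z₁ + z₂
      z₃ = z₂ + a * x₂ * (1ℚ + d * x₂) * z₁ + (c + d) * x₂ * t₁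
      z₄ = z₃ + a * x₃ * (1ℚ + d * x₃) * z₂ + (c + d) * x₃ * t₂
      Q₁₁ = q * x * z₁ + x * (1ℚ - c * x₁) * z₀
      Q₁₂ = q * x₁ * z₂ + x₁ * (1ℚ - c * x₂) * z₁
      Q₂₂ = q * x₁ * Q₁₂ + x₁ * (1ℚ - c * x₂) * Q₁₁
  in z₄ ≡ c * x₃ * z₃ + (z₂ + (a + d) * q * Q₁₂ + a * d * (q * q) * Q₂₂ + c * x₂ * (z₃ - c * x₂ * z₂))
coupled-identity = solve-∀ ℚ-ring

module Recurrence (q a c d : ℚ) where

  -- If r = S 1 φ, then qstep (q^n) (r n) (r (n+1)) is the value at n + 1 of S 1 (λ j → q^j φ_j) (see S-qshift).
  qstep : (x r₀ r₁ : ℚ) → ℚ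
  qstep x r₀ r₁ = q * x * r₁ + x * (1ℚ - c * (q * x)) * r₀

  -- The fourth-order recurrence r(n+4) = step (q^n) r(n) r(n+1) r(n+2) r(n+3) shared by both sides.
  step : (x r₀ r₁ r₂ r₃ : ℚ) → ℚ
  step x r₀ r₁ r₂ r₃ = c * (q * x₂) * r₃ + (h + c * x₂ * (r₃ - c * x₂ * r₂))
    where
    x₁ = q * x
    x₂ = q * x₁
    h  = r₂ + (a + d) * q * qstep x₁ r₁ r₂ + a * d * (q * q) * qstep x₁ (qstep x r₀ r₁) (qstep x₁ r₁ r₂)

  coupled⇒step : ∀ x {z₀ z₁ z₂ z₃ z₄ t₀ t₁ t₂} →
    t₁ ≡ c * (q * x) * t₀ + a * (q * x) * z₀ + z₁ →
    z₂ ≡ z₁ + a * (q * x) * (1ℚ + d * (q * x)) * z₀ + (c + d) * (q * x) * t₀ →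
    t₂ ≡ c * (q * (q * x)) * t₁ + a * (q * (q * x)) * z₁ + z₂ →
    z₃ ≡ z₂ + a * (q * (q * x)) * (1ℚ + d * (q * (q * x))) * z₁ + (c + d) * (q * (q * x)) * t₁ →
    z₄ ≡ z₃ + a * (q * (q * (q * x))) * (1ℚ + d * (q * (q * (q * x)))) * z₂ + (c + d) * (q * (q * (q * x))) * t₂ →
    z₄ ≡ step x z₀ z₁ z₂ z₃
  coupled⇒step x {z₀} {z₁} {t₀ = t₀} refl refl refl refl refl = coupled-identity q a c d x z₀ z₁ t₀

  step-cong : ∀ x {r₀ r₁ r₂ r₃ s₀ s₁ s₂ s₃} → r₀ ≡ s₀ → r₁ ≡ s₁ → r₂ ≡ s₂ → r₃ ≡ s₃ →
              step x r₀ r₁ r₂ r₃ ≡ step x s₀ s₁ s₂ s₃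
  step-cong x refl refl refl refl = refl

module Series (q a c d : ℚ) where
  open QFactorial q
  open Expansion q c
  open Recurrence q a c d

  g : ℕ → ℚ
  g i = (1ℚ + a * q ^ i) * (1ℚ + d * q ^ i)

  w : ℕ → ℚ
  w i = poch c q i * q ^ i * ι i

  v : ℕ → ℚ
  v zero          = sgn 0 * w 0
  v (suc zero)    = sgn 1 * w 1
  v (suc (suc j)) = g (suc j) * v j + sgn (suc (suc j)) * w (suc (suc j))

  gv : ℕ → ℚ
  gv j = g (suc j) * v j

  R Y H Θ Q₁ Q₂ : ℕ → ℚ
  R n  = S 1 v n
  Y n  = S 0 v (suc n)
  H n  = S 1 gv n
  Θ n  = S 0 (λ i → sgn i * w i) n
  Q₁ n = S 1 (λ j → q ^ j * v j) n
  Q₂ n = S 1 (λ j → q ^ j * (q ^ j * v j)) n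

  Y-split : ∀ n → Y (suc n) ≡ Θ (suc (suc n)) + S 2 gv n
  Y-split n = begin
    v 0 * E 0 (suc (suc n)) + (v 1 * E 1 (suc n) + Σ+ n (λ j m → v (suc (suc j)) * E (suc (suc j)) m))
      ≡⟨ cong (λ t → v 0 * E 0 (suc (suc n)) + (v 1 * E 1 (suc n) + t))
           (trans (Σ+-cong n (λ j m _ → ℚ.*-distribʳ-+ (E (suc (suc j)) m) (gv j) _)) (Σ+-+ n (λ j m → gv j * E (suc (suc j)) m) _)) ⟩
    v 0 * E 0 (suc (suc n)) + (v 1 * E 1 (suc n) + (S 2 gv n + Σ+ n (λ j m → sgn (suc (suc j)) * w (suc (suc j)) * E (suc (suc j)) m)))
      ≡⟨ rotate (v 0 * E 0 (suc (suc n))) (v 1 * E 1 (suc n)) (S 2 gv n) _ ⟩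
    Θ (suc (suc n)) + S 2 gv n ∎
    where
    rotate : ∀ a b x y → a + (b + (x + y)) ≡ a + (b + y) + x
    rotate = solve-∀ ℚ-ring

  Θ-alternating : ∀ n → Θ n ≡ poch c q n * alternating q n
  Θ-alternating n = begin
    Σ+ n (λ i m → sgn i * w i * E i m)
      ≡⟨ Σ+-cong n pointwise ⟩
    Σ+ n (λ i m → poch c q n * (q ^ i * (sgn i * ι i) * ε m))
      ≡⟨ sym (*-distribˡ-Σ+ n (poch c q n) (λ i m → q ^ i * (sgn i * ι i) * ε m)) ⟩
    poch c q n * alternating q n ∎
    where
    pointwise : ∀ i m → i ℕ.+ m ≡ n → sgn i * w i * E i m ≡ poch c q n * (q ^ i * (sgn i * ι i) * ε m)
    pointwise i m refl = begin
      sgn i * (poch c q i * q ^ i * ι i) * (poch (c * q ^ i) q m * ε m)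
        ≡⟨ regroup (sgn i) (poch c q i) (q ^ i) (ι i) (poch (c * q ^ i) q m) (ε m) ⟩
      poch c q i * poch (c * q ^ i) q m * (q ^ i * (sgn i * ι i) * ε m)
        ≡⟨ cong (_* (q ^ i * (sgn i * ι i) * ε m)) (sym (poch-+ c q i m)) ⟩
      poch c q (i ℕ.+ m) * (q ^ i * (sgn i * ι i) * ε m) ∎
      where
      regroup : ∀ s P t i Q e → s * (P * t * i) * (Q * e) ≡ P * Q * (t * (s * i) * e)
      regroup = solve-∀ ℚ-ring

  H-split : ∀ n → H n ≡ R n + (a + d) * q * Q₁ n + a * d * (q * q) * Q₂ n
  H-split n = begin
    S 1 gv n
      ≡⟨ S-cong 1 n (λ j _ → expand a d q (q ^ j) (v j)) ⟩
    S 1 (λ j → v j + (a + d) * q * (q ^ j * v j) + a * d * (q * q) * (q ^ j * (q ^ j * v j))) n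
      ≡⟨ S-+ 1 (λ j → v j + (a + d) * q * (q ^ j * v j)) (λ j → a * d * (q * q) * (q ^ j * (q ^ j * v j))) n ⟩
    S 1 (λ j → v j + (a + d) * q * (q ^ j * v j)) n + S 1 (λ j → a * d * (q * q) * (q ^ j * (q ^ j * v j))) n
      ≡⟨ cong₂ _+_ (trans (S-+ 1 v (λ j → (a + d) * q * (q ^ j * v j)) n)
                          (cong (R n +_) (sym (*-distribˡ-S 1 ((a + d) * q) (λ j → q ^ j * v j) n))))
                   (sym (*-distribˡ-S 1 (a * d * (q * q)) (λ j → q ^ j * (q ^ j * v j)) n)) ⟩
    R n + (a + d) * q * Q₁ n + a * d * (q * q) * Q₂ n ∎
    where
    expand : ∀ a d q t v → (1ℚ + a * (q * t)) * (1ℚ + d * (q * t)) * v ≡ v + (a + d) * q * (t * v) + a * d * (q * q) * (t * (t * v))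
    expand = solve-∀ ℚ-ring

  module _ {N : ℕ} (q^i≢1 : ∀ i → 1 ≤ i → i ≤ N → q ^ i ≢ 1ℚ) where

    Θ-vanishes : ∀ {n} → suc (suc n) ≤ N → Θ (suc (suc n)) ≡ 0ℚ
    Θ-vanishes {n} le = begin
      Θ (suc (suc n))                                    ≡⟨ Θ-alternating (suc (suc n)) ⟩
      poch c q (suc (suc n)) * alternating q (suc (suc n)) ≡⟨ cong (poch c q (suc (suc n)) *_) (alternating-q q^i≢1 le) ⟩
      poch c q (suc (suc n)) * 0ℚ                        ≡⟨ ℚ.*-zeroʳ (poch c q (suc (suc n))) ⟩
      0ℚ                                                 ∎

    R-suc : ∀ {n} → suc n ≤ N → R (suc n) ≡ c * q ^ n * R n + Y n
    R-suc {n} le = trans (S-pascal q^i≢1 0 v le) (ℚ.+-comm (Y n) (c * q ^ n * R n))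

    Y-as-R : ∀ {n} → suc n ≤ N → Y n ≡ R (suc n) - c * q ^ n * R n
    Y-as-R {n} le = begin
      Y n                                        ≡⟨ cancel (Y n) (c * q ^ n * R n) ⟩
      c * q ^ n * R n + Y n - c * q ^ n * R n    ≡⟨ cong (_- c * q ^ n * R n) (sym (R-suc le)) ⟩
      R (suc n) - c * q ^ n * R n                ∎
      where
      cancel : ∀ y x → y ≡ x + y - x
      cancel = solve-∀ ℚ-ring

    Y-suc : ∀ {n} → suc (suc (suc n)) ≤ N → Y (suc (suc n)) ≡ H (suc n) + c * q ^ suc n * Y (suc n)
    Y-suc {n} le = begin
      Y (suc (suc n))
        ≡⟨ Y-split (suc n) ⟩
      Θ (suc (suc (suc n))) + S 2 gv (suc n)
        ≡⟨ cong₂ _+_ (Θ-vanishes le) (S-pascal q^i≢1 1 gv {n} (ℕ.<⇒≤ (ℕ.<⇒≤ le))) ⟩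
      0ℚ + (H (suc n) + c * q ^ suc n * S 2 gv n)
        ≡⟨ ℚ.+-identityˡ _ ⟩
      H (suc n) + c * q ^ suc n * S 2 gv n
        ≡⟨ cong (λ t → H (suc n) + c * q ^ suc n * t) (sym Y≡S) ⟩
      H (suc n) + c * q ^ suc n * Y (suc n) ∎
      where
      Y≡S : Y (suc n) ≡ S 2 gv n
      Y≡S = trans (Y-split n) (trans (cong (_+ S 2 gv n) (Θ-vanishes (ℕ.<⇒≤ le))) (ℚ.+-identityˡ _))

    Q₁-suc : ∀ {n} → suc n ≤ N → Q₁ (suc n) ≡ qstep (q ^ n) (R n) (R (suc n))
    Q₁-suc le = S-qshift q^i≢1 1 v le

    Q₂-suc : ∀ {n} → suc n ≤ N → Q₂ (suc n) ≡ qstep (q ^ n) (Q₁ n) (Q₁ (suc n))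
    Q₂-suc le = S-qshift q^i≢1 1 (λ j → q ^ j * v j) le

    R-step : ∀ n → 4 ℕ.+ n ≤ N → R (4 ℕ.+ n) ≡ step (q ^ n) (R n) (R (1 ℕ.+ n)) (R (2 ℕ.+ n)) (R (3 ℕ.+ n))
    R-step n le = begin
      R (4 ℕ.+ n)
        ≡⟨ R-suc le ⟩
      c * q ^ (3 ℕ.+ n) * R (3 ℕ.+ n) + Y (3 ℕ.+ n)
        ≡⟨ cong (c * q ^ (3 ℕ.+ n) * R (3 ℕ.+ n) +_) (Y-suc le) ⟩
      c * q ^ (3 ℕ.+ n) * R (3 ℕ.+ n) + (H (2 ℕ.+ n) + c * q ^ (2 ℕ.+ n) * Y (2 ℕ.+ n))
        ≡⟨ cong₂ (λ h y → c * q ^ (3 ℕ.+ n) * R (3 ℕ.+ n) + (h + c * q ^ (2 ℕ.+ n) * y)) H-expand (Y-as-R le₃) ⟩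
      step (q ^ n) (R n) (R (1 ℕ.+ n)) (R (2 ℕ.+ n)) (R (3 ℕ.+ n)) ∎
      where
      le₃ = ℕ.<⇒≤ le
      le₂ = ℕ.<⇒≤ le₃
      le₁ = ℕ.<⇒≤ le₂
      H-expand : H (2 ℕ.+ n) ≡ R (2 ℕ.+ n) + (a + d) * q * qstep (q ^ suc n) (R (1 ℕ.+ n)) (R (2 ℕ.+ n))
                   + a * d * (q * q) * qstep (q ^ suc n) (qstep (q ^ n) (R n) (R (1 ℕ.+ n))) (qstep (q ^ suc n) (R (1 ℕ.+ n)) (R (2 ℕ.+ n)))
      H-expand = trans (H-split (2 ℕ.+ n))
        (cong₂ (λ y z → R (2 ℕ.+ n) + (a + d) * q * y + a * d * (q * q) * z)
               (Q₁-suc le₂)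
               (trans (Q₂-suc le₂) (cong₂ (qstep (q ^ suc n)) (Q₁-suc le₁) (Q₁-suc le₂))))

    Y-zero : 1 ≤ N → Y 0 ≡ 1ℚ - c
    Y-zero le = begin
      Θ 1                          ≡⟨ Θ-alternating 1 ⟩
      poch c q 1 * alternating q 1 ≡⟨ cong (poch c q 1 *_) (alternating-q-1 q^i≢1 le) ⟩
      1ℚ * (1ℚ - c * 1ℚ) * 1ℚ      ≡⟨ simplify c ⟩
      1ℚ - c                       ∎
      where
      simplify : ∀ c → 1ℚ * (1ℚ - c * 1ℚ) * 1ℚ ≡ 1ℚ - c
      simplify = solve-∀ ℚ-ring

    R-one : 1 ≤ N → R 1 ≡ 1ℚ
    R-one le = begin
      R 1                     ≡⟨ R-suc le ⟩
      c * 1ℚ * 1ℚ + Y 0       ≡⟨ cong (c * 1ℚ * 1ℚ +_) (Y-zero le) ⟩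
      c * 1ℚ * 1ℚ + (1ℚ - c)  ≡⟨ simplify c ⟩
      1ℚ                      ∎
      where
      simplify : ∀ c → c * 1ℚ * 1ℚ + (1ℚ - c) ≡ 1ℚ
      simplify = solve-∀ ℚ-ring

    Y-one : 2 ≤ N → Y 1 ≡ g 1
    Y-one le = begin
      Y 1                         ≡⟨ Y-split 0 ⟩
      Θ 2 + g 1 * 1ℚ * 1ℚ         ≡⟨ cong (_+ g 1 * 1ℚ * 1ℚ) (Θ-vanishes le) ⟩
      0ℚ + g 1 * 1ℚ * 1ℚ          ≡⟨ simplify (g 1) ⟩
      g 1                         ∎
      where
      simplify : ∀ x → 0ℚ + x * 1ℚ * 1ℚ ≡ x
      simplify = solve-∀ ℚ-ring

data Parity : ℕ → Set where
  even : ∀ n → Parity (2 ℕ.* n)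
  odd  : ∀ n → Parity (2 ℕ.* n ℕ.+ 1)

parity-view : ∀ j → Parity j
parity-view zero          = even 0
parity-view (suc zero)    = odd 0
parity-view (suc (suc j)) with parity-view j
... | even n = subst Parity (ℕ.*-suc 2 n) (even (suc n))
... | odd n  = subst Parity (cong (ℕ._+ 1) (ℕ.*-suc 2 n)) (odd (suc n))

parity-even : ∀ n → parity (2 ℕ.* n) ≡ inj₁ n
parity-even zero = refl
parity-even (suc n) rewrite ℕ.*-suc 2 n | parity-even n = refl

parity-odd : ∀ n → parity (2 ℕ.* n ℕ.+ 1) ≡ inj₂ n
parity-odd zero = refl
parity-odd (suc n) rewrite cong (ℕ._+ 1) (ℕ.*-suc 2 n) | parity-odd n = refl

u-at-even : ∀ q a b c d n → u q a b c d (2 ℕ.* n) ≡ uEven q a b c d n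
u-at-even q a b c d n rewrite parity-even n = refl

u-at-odd : ∀ q a b c d n → u q a b c d (2 ℕ.* n ℕ.+ 1) ≡ uOdd q a b c d n
u-at-odd q a b c d n rewrite parity-odd n = refl

module UFormula (q a c d : ℚ) where
  open QFactorial q
  open Series q a c d

  sgn-even : ∀ n → sgn (2 ℕ.* n) ≡ 1ℚ
  sgn-even zero    = refl
  sgn-even (suc n) = begin
    sgn (2 ℕ.* suc n)    ≡⟨ cong sgn (ℕ.*-suc 2 n) ⟩
    - - sgn (2 ℕ.* n)    ≡⟨ solve-neg (sgn (2 ℕ.* n)) ⟩
    sgn (2 ℕ.* n)        ≡⟨ sgn-even n ⟩
    1ℚ                   ∎
    where
    solve-neg : ∀ x → - - x ≡ x
    solve-neg = solve-∀ ℚ-ring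

  Pad : ℕ → ℕ → ℚ
  Pad k m = poch (- a * q ^ k) (q ^ 2) m * poch (- d * q ^ k) (q ^ 2) m

  Pad-suc : ∀ k m → Pad k (suc m) ≡ Pad k m * g (k ℕ.+ 2 ℕ.* m)
  Pad-suc k m = begin
    Pa * (1ℚ - - a * q ^ k * (q ^ 2) ^ m) * (Pd * (1ℚ - - d * q ^ k * (q ^ 2) ^ m))
      ≡⟨ cong (λ t → Pa * (1ℚ - - a * q ^ k * t) * (Pd * (1ℚ - - d * q ^ k * t))) (^2-^ q m) ⟩
    Pa * (1ℚ - - a * q ^ k * q ^ (2 ℕ.* m)) * (Pd * (1ℚ - - d * q ^ k * q ^ (2 ℕ.* m)))
      ≡⟨ regroup Pa Pd a d (q ^ k) (q ^ (2 ℕ.* m)) ⟩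
    Pa * Pd * ((1ℚ + a * (q ^ k * q ^ (2 ℕ.* m))) * (1ℚ + d * (q ^ k * q ^ (2 ℕ.* m))))
      ≡⟨ cong (λ t → Pa * Pd * ((1ℚ + a * t) * (1ℚ + d * t))) (^-+-≡ q k (2 ℕ.* m) refl) ⟩
    Pad k m * g (k ℕ.+ 2 ℕ.* m) ∎
    where
    Pa = poch (- a * q ^ k) (q ^ 2) m
    Pd = poch (- d * q ^ k) (q ^ 2) m
    regroup : ∀ Pa Pd a d s t → Pa * (1ℚ - - a * s * t) * (Pd * (1ℚ - - d * s * t)) ≡ Pa * Pd * ((1ℚ + a * (s * t)) * (1ℚ + d * (s * t)))
    regroup = solve-∀ ℚ-ring

  -- The index map e is ℓ ↦ 2ℓ for the even u_j and ℓ ↦ 2ℓ + 1 for the odd ones.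
  V : (ℕ → ℕ) → ℕ → ℚ
  V e n = Σ< (suc n) (λ ℓ → w (e ℓ) * Pad (suc (e ℓ)) (n ∸ ℓ))

  V-suc : ∀ e → (∀ ℓ m → e ℓ ℕ.+ 2 ℕ.* m ≡ e (ℓ ℕ.+ m)) → ∀ n → V e (suc n) ≡ g (suc (e n)) * V e n + w (e (suc n))
  V-suc e shift n = begin
    Σ< (suc n) (λ ℓ → w (e ℓ) * Pad (suc (e ℓ)) (suc n ∸ ℓ)) + w (e (suc n)) * Pad (suc (e (suc n))) (n ∸ n)
      ≡⟨ cong₂ _+_ (Σ<-cong (suc n) pointwise) (cong (λ m → w (e (suc n)) * Pad (suc (e (suc n))) m) (ℕ.n∸n≡0 n)) ⟩
    Σ< (suc n) (λ ℓ → g (suc (e n)) * (w (e ℓ) * Pad (suc (e ℓ)) (n ∸ ℓ))) + w (e (suc n)) * (1ℚ * 1ℚ)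
      ≡⟨ cong₂ _+_ (sym (*-distribˡ-Σ< (suc n) (g (suc (e n))) _)) (ℚ.*-identityʳ (w (e (suc n)))) ⟩
    g (suc (e n)) * V e n + w (e (suc n)) ∎
    where
    pointwise : ∀ ℓ → ℓ ℕ.< suc n →
      w (e ℓ) * Pad (suc (e ℓ)) (suc n ∸ ℓ) ≡ g (suc (e n)) * (w (e ℓ) * Pad (suc (e ℓ)) (n ∸ ℓ))
    pointwise ℓ (s≤s ℓ≤n) = begin
      w (e ℓ) * Pad (suc (e ℓ)) (suc n ∸ ℓ)
        ≡⟨ cong (λ m → w (e ℓ) * Pad (suc (e ℓ)) m) (ℕ.+-∸-assoc 1 ℓ≤n) ⟩
      w (e ℓ) * Pad (suc (e ℓ)) (suc (n ∸ ℓ))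
        ≡⟨ cong (w (e ℓ) *_) (Pad-suc (suc (e ℓ)) (n ∸ ℓ)) ⟩
      w (e ℓ) * (Pad (suc (e ℓ)) (n ∸ ℓ) * g (suc (e ℓ ℕ.+ 2 ℕ.* (n ∸ ℓ))))
        ≡⟨ cong (λ i → w (e ℓ) * (Pad (suc (e ℓ)) (n ∸ ℓ) * g (suc i))) (trans (shift ℓ (n ∸ ℓ)) (cong e (ℕ.m+[n∸m]≡n ℓ≤n))) ⟩
      w (e ℓ) * (Pad (suc (e ℓ)) (n ∸ ℓ) * g (suc (e n)))
        ≡⟨ rotate (w (e ℓ)) (Pad (suc (e ℓ)) (n ∸ ℓ)) (g (suc (e n))) ⟩
      g (suc (e n)) * (w (e ℓ) * Pad (suc (e ℓ)) (n ∸ ℓ)) ∎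
      where
      rotate : ∀ x y z → x * (y * z) ≡ z * (x * y)
      rotate = solve-∀ ℚ-ring

  evenᵉ oddᵉ : ℕ → ℕ
  evenᵉ ℓ = 2 ℕ.* ℓ
  oddᵉ ℓ = 2 ℕ.* ℓ ℕ.+ 1

  v-even : ∀ n → v (2 ℕ.* n) ≡ V evenᵉ n
  v-even zero    = refl
  v-even (suc n) = begin
    v (2 ℕ.* suc n)
      ≡⟨ cong v (ℕ.*-suc 2 n) ⟩
    g (suc (2 ℕ.* n)) * v (2 ℕ.* n) + sgn (suc (suc (2 ℕ.* n))) * w (suc (suc (2 ℕ.* n)))
      ≡⟨ cong₂ (λ x s → g (suc (2 ℕ.* n)) * x + s * w (suc (suc (2 ℕ.* n))))
           (v-even n) (trans (cong sgn (sym (ℕ.*-suc 2 n))) (sgn-even (suc n))) ⟩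
    g (suc (2 ℕ.* n)) * V evenᵉ n + 1ℚ * w (suc (suc (2 ℕ.* n)))
      ≡⟨ cong (g (suc (2 ℕ.* n)) * V evenᵉ n +_) (trans (ℚ.*-identityˡ _) (cong w (sym (ℕ.*-suc 2 n)))) ⟩
    g (suc (2 ℕ.* n)) * V evenᵉ n + w (2 ℕ.* suc n)
      ≡⟨ sym (V-suc evenᵉ (λ ℓ m → sym (ℕ.*-distribˡ-+ 2 ℓ m)) n) ⟩
    V evenᵉ (suc n) ∎

  v-odd : ∀ n → v (2 ℕ.* n ℕ.+ 1) ≡ - V oddᵉ n
  v-odd zero    = simplify (w 1)
    where
    simplify : ∀ x → - 1ℚ * x ≡ - (0ℚ + x * (1ℚ * 1ℚ))
    simplify = solve-∀ ℚ-ring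
  v-odd (suc n) = begin
    v (2 ℕ.* suc n ℕ.+ 1)
      ≡⟨ cong v odd-suc ⟩
    g (suc (oddᵉ n)) * v (oddᵉ n) + sgn (suc (suc (oddᵉ n))) * w (suc (suc (oddᵉ n)))
      ≡⟨ cong₂ (λ x s → g (suc (oddᵉ n)) * x + s * w (suc (suc (oddᵉ n))))
           (v-odd n) (trans (cong sgn (trans (sym odd-suc) (ℕ.+-comm (2 ℕ.* suc n) 1))) (cong -_ (sgn-even (suc n)))) ⟩
    g (suc (oddᵉ n)) * - V oddᵉ n + - 1ℚ * w (suc (suc (oddᵉ n)))
      ≡⟨ cong (λ i → g (suc (oddᵉ n)) * - V oddᵉ n + - 1ℚ * w i) (sym odd-suc) ⟩
    g (suc (oddᵉ n)) * - V oddᵉ n + - 1ℚ * w (oddᵉ (suc n))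
      ≡⟨ pull-neg (g (suc (oddᵉ n))) (V oddᵉ n) (w (oddᵉ (suc n))) ⟩
    - (g (suc (oddᵉ n)) * V oddᵉ n + w (oddᵉ (suc n)))
      ≡⟨ cong -_ (sym (V-suc oddᵉ odd-shift n)) ⟩
    - V oddᵉ (suc n) ∎
    where
    odd-suc : 2 ℕ.* suc n ℕ.+ 1 ≡ suc (suc (2 ℕ.* n ℕ.+ 1))
    odd-suc = cong (ℕ._+ 1) (ℕ.*-suc 2 n)
    odd-shift : ∀ ℓ m → 2 ℕ.* ℓ ℕ.+ 1 ℕ.+ 2 ℕ.* m ≡ 2 ℕ.* (ℓ ℕ.+ m) ℕ.+ 1
    odd-shift = ℕ-solve-∀
    pull-neg : ∀ x y z → x * - y + - 1ℚ * z ≡ - (x * y + z)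
    pull-neg = solve-∀ ℚ-ring

  term : ℕ → ℕ → ℕ → ℚ
  term i i′ m = (Pad i′ m ÷ (poch (c * q ^ i) (q ^ 2) (m ℕ.+ 1) * poch (c * q ^ i′) (q ^ 2) m)) * (q ^ i ÷ poch q q i)

  -- (1 − c) / (c q^i; q)_(2m+1) = (c; q)_i / (cq; q)_J, as (1 − c)(cq; q)_J = (c; q)_(J+1) = (c; q)_i (c q^i; q)_(2m+1).
  term-scaled : ∀ i i′ m J → i′ ≡ suc i → i ℕ.+ suc (2 ℕ.* m) ≡ suc J → poch c q (suc J) ≢ 0ℚ →
    (1ℚ - c) * term i i′ m ≡ inv (poch (c * q) q J) * (w i * Pad (suc i) m)
  term-scaled i .(suc i) m J refl i+2m+1≡J+1 P≢0 = begin
    (1ℚ - c) * (Pad (suc i) m * inv Den * (q ^ i * ι i))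
      ≡⟨ regroup (1ℚ - c) (Pad (suc i) m) (inv Den) (q ^ i * ι i) ⟩
    (1ℚ - c) * inv Den * (Pad (suc i) m * (q ^ i * ι i))
      ≡⟨ cong (_* (Pad (suc i) m * (q ^ i * ι i))) (*-inv-cross (1ℚ - c) (poch c q i) X≢0 Den≢0 factorise) ⟩
    poch c q i * inv X * (Pad (suc i) m * (q ^ i * ι i))
      ≡⟨ regroup′ (poch c q i) (inv X) (Pad (suc i) m) (q ^ i) (ι i) ⟩
    inv X * (w i * Pad (suc i) m) ∎
    where
    x   = c * q ^ i
    X   = poch (c * q) q J
    Den = poch x (q ^ 2) (m ℕ.+ 1) * poch (c * q ^ suc i) (q ^ 2) m
    Den≡ : Den ≡ poch x q (suc (2 ℕ.* m))
    Den≡ = trans (cong₂ (λ k y → poch x (q ^ 2) k * poch y (q ^ 2) m) (ℕ.+-comm m 1) (*-^-suc c q i))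
                 (sym (poch-odd x q m))
    front : poch c q (suc J) ≡ (1ℚ - c) * X
    front = poch-suc c q J
    split : poch c q (suc J) ≡ poch c q i * Den
    split = begin
      poch c q (suc J)                          ≡⟨ cong (poch c q) (sym i+2m+1≡J+1) ⟩
      poch c q (i ℕ.+ suc (2 ℕ.* m))            ≡⟨ poch-+ c q i (suc (2 ℕ.* m)) ⟩
      poch c q i * poch x q (suc (2 ℕ.* m))     ≡⟨ cong (poch c q i *_) (sym Den≡) ⟩
      poch c q i * Den                          ∎
    factorise : (1ℚ - c) * X ≡ poch c q i * Den
    factorise = trans (sym front) split
    X≢0   = *-≢0⇒≢0ʳ (1ℚ - c) (subst (_≢ 0ℚ) front P≢0)
    Den≢0 = *-≢0⇒≢0ʳ (poch c q i) (subst (_≢ 0ℚ) split P≢0)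
    regroup : ∀ r P i Q → r * (P * i * Q) ≡ r * i * (P * Q)
    regroup = solve-∀ ℚ-ring
    regroup′ : ∀ C iX P t ι → C * iX * (P * (t * ι)) ≡ iX * (C * t * ι * P)
    regroup′ = solve-∀ ℚ-ring

  u-sum : ∀ (e e′ : ℕ → ℕ) n J → (∀ ℓ → e′ ℓ ≡ suc (e ℓ)) → (∀ ℓ → ℓ ≤ n → e ℓ ℕ.+ suc (2 ℕ.* (n ∸ ℓ)) ≡ suc J) →
    poch c q (suc J) ≢ 0ℚ → (1ℚ - c) * Σ< (suc n) (λ ℓ → term (e ℓ) (e′ ℓ) (n ∸ ℓ)) ≡ V e n * inv (poch (c * q) q J)
  u-sum e e′ n J e′≡ total P≢0 = begin
    (1ℚ - c) * Σ< (suc n) (λ ℓ → term (e ℓ) (e′ ℓ) (n ∸ ℓ))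
      ≡⟨ *-distribˡ-Σ< (suc n) (1ℚ - c) (λ ℓ → term (e ℓ) (e′ ℓ) (n ∸ ℓ)) ⟩
    Σ< (suc n) (λ ℓ → (1ℚ - c) * term (e ℓ) (e′ ℓ) (n ∸ ℓ))
      ≡⟨ Σ<-cong (suc n) scaled ⟩
    Σ< (suc n) (λ ℓ → inv X * (w (e ℓ) * Pad (suc (e ℓ)) (n ∸ ℓ)))
      ≡⟨ sym (*-distribˡ-Σ< (suc n) (inv X) (λ ℓ → w (e ℓ) * Pad (suc (e ℓ)) (n ∸ ℓ))) ⟩
    inv X * V e n
      ≡⟨ ℚ.*-comm (inv X) (V e n) ⟩
    V e n * inv X ∎
    where
    X = poch (c * q) q J
    scaled : ∀ ℓ → ℓ ℕ.< suc n → (1ℚ - c) * term (e ℓ) (e′ ℓ) (n ∸ ℓ) ≡ inv X * (w (e ℓ) * Pad (suc (e ℓ)) (n ∸ ℓ))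
    scaled ℓ (s≤s ℓ≤n) = term-scaled (e ℓ) (e′ ℓ) (n ∸ ℓ) J (e′≡ ℓ) (total ℓ ℓ≤n) P≢0

  module _ {N : ℕ} (c*q^i≢1 : ∀ i → i ≤ N → c * q ^ i ≢ 1ℚ) where

    poch-c≢0 : ∀ {J} → J ≤ N → poch c q (suc J) ≢ 0ℚ
    poch-c≢0 {J} le = poch-≢0 c q (suc J) (λ { i (s≤s i≤J) → c*q^i≢1 i (ℕ.≤-trans i≤J le) })

    u-as-v : ∀ j → j ≤ N → u q a c c d j ≡ v j * inv (poch (c * q) q j)
    u-as-v j le with parity-view j
    ... | even n = begin
      u q a c c d (2 ℕ.* n)
        ≡⟨ u-at-even q a c c d n ⟩
      (1ℚ - c) * Σ< (suc n) (λ ℓ → term (evenᵉ ℓ) (oddᵉ ℓ) (n ∸ ℓ))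
        ≡⟨ u-sum evenᵉ oddᵉ n (2 ℕ.* n) (λ ℓ → ℕ.+-comm (2 ℕ.* ℓ) 1) total (poch-c≢0 le) ⟩
      V evenᵉ n * inv (poch (c * q) q (2 ℕ.* n))
        ≡⟨ cong (_* inv (poch (c * q) q (2 ℕ.* n))) (sym (v-even n)) ⟩
      v (2 ℕ.* n) * inv (poch (c * q) q (2 ℕ.* n)) ∎
      where
      total : ∀ ℓ → ℓ ≤ n → 2 ℕ.* ℓ ℕ.+ suc (2 ℕ.* (n ∸ ℓ)) ≡ suc (2 ℕ.* n)
      total ℓ ℓ≤n = trans (arith ℓ (n ∸ ℓ)) (cong (λ k → suc (2 ℕ.* k)) (ℕ.m+[n∸m]≡n ℓ≤n))
        where
        arith : ∀ ℓ m → 2 ℕ.* ℓ ℕ.+ suc (2 ℕ.* m) ≡ suc (2 ℕ.* (ℓ ℕ.+ m))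
        arith = ℕ-solve-∀
    ... | odd n = begin
      u q a c c d (2 ℕ.* n ℕ.+ 1)
        ≡⟨ u-at-odd q a c c d n ⟩
      (c - 1ℚ) * Σ
        ≡⟨ flip-sign c Σ ⟩
      - ((1ℚ - c) * Σ)
        ≡⟨ cong -_ (u-sum oddᵉ (λ ℓ → 2 ℕ.* ℓ ℕ.+ 2) n (2 ℕ.* n ℕ.+ 1) (λ ℓ → suc-odd ℓ) total (poch-c≢0 le)) ⟩
      - (V oddᵉ n * inv X)
        ≡⟨ ℚ.neg-distribˡ-* (V oddᵉ n) (inv X) ⟩
      - V oddᵉ n * inv X
        ≡⟨ cong (_* inv X) (sym (v-odd n)) ⟩
      v (2 ℕ.* n ℕ.+ 1) * inv X ∎
      where
      Σ = Σ< (suc n) (λ ℓ → term (oddᵉ ℓ) (2 ℕ.* ℓ ℕ.+ 2) (n ∸ ℓ))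
      X = poch (c * q) q (2 ℕ.* n ℕ.+ 1)
      flip-sign : ∀ c s → (c - 1ℚ) * s ≡ - ((1ℚ - c) * s)
      flip-sign = solve-∀ ℚ-ring
      suc-odd : ∀ ℓ → 2 ℕ.* ℓ ℕ.+ 2 ≡ suc (2 ℕ.* ℓ ℕ.+ 1)
      suc-odd = ℕ-solve-∀
      total : ∀ ℓ → ℓ ≤ n → 2 ℕ.* ℓ ℕ.+ 1 ℕ.+ suc (2 ℕ.* (n ∸ ℓ)) ≡ suc (2 ℕ.* n ℕ.+ 1)
      total ℓ ℓ≤n = trans (arith ℓ (n ∸ ℓ)) (cong (λ k → suc (2 ℕ.* k ℕ.+ 1)) (ℕ.m+[n∸m]≡n ℓ≤n))
        where
        arith : ∀ ℓ m → 2 ℕ.* ℓ ℕ.+ 1 ℕ.+ suc (2 ℕ.* m) ≡ suc (2 ℕ.* (ℓ ℕ.+ m) ℕ.+ 1)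
        arith = ℕ-solve-∀

    RHS≡R : ∀ k → suc k ≤ N → RHS k q a c d ≡ R (suc k)
    RHS≡R k le = begin
      RHS k q a c d
        ≡⟨ *-distribˡ-Σ< (suc (suc k)) (poch (c * q) q (suc k)) _ ⟩
      Σ< (suc (suc k)) (λ j → poch (c * q) q (suc k) * (u q a c c d j * q ^ ((suc k ∸ j) C 2) ÷ poch q q (suc k ∸ j)))
        ≡⟨ Σ<-as-Σ+ (suc k) _ (λ j m → v j * E (suc j) m) pointwise ⟩
      R (suc k) ∎
      where
      open Expansion q c using (E)
      pointwise : ∀ j m → j ℕ.+ m ≡ suc k →
        poch (c * q) q (suc k) * (u q a c c d j * q ^ ((suc k ∸ j) C 2) ÷ poch q q (suc k ∸ j)) ≡ v j * E (suc j) m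
      pointwise j m j+m≡ = begin
        poch (c * q) q (suc k) * (u q a c c d j * q ^ ((suc k ∸ j) C 2) * ι (suc k ∸ j))
          ≡⟨ cong (λ i → poch (c * q) q (suc k) * (u q a c c d j * q ^ (i C 2) * ι i)) k+1-j≡m ⟩
        poch (c * q) q (suc k) * (u q a c c d j * q ^ (m C 2) * ι m)
          ≡⟨ cong₂ (λ P x → P * (x * q ^ (m C 2) * ι m)) split (u-as-v j j≤N) ⟩
        Pj * poch (c * q ^ suc j) q m * (v j * inv Pj * q ^ (m C 2) * ι m)
          ≡⟨ regroup Pj (poch (c * q ^ suc j) q m) (v j) (inv Pj) (q ^ (m C 2)) (ι m) ⟩
        v j * E (suc j) m * (Pj * inv Pj)
          ≡⟨ cong (v j * E (suc j) m *_) (inv-inverseʳ Pj Pj≢0) ⟩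
        v j * E (suc j) m * 1ℚ
          ≡⟨ ℚ.*-identityʳ _ ⟩
        v j * E (suc j) m ∎
        where
        Pj = poch (c * q) q j
        j≤N : j ≤ N
        j≤N = ℕ.≤-trans (+≡⇒≤ˡ j+m≡) le
        k+1-j≡m : suc k ∸ j ≡ m
        k+1-j≡m = trans (cong (_∸ j) (sym j+m≡)) (ℕ.m+n∸m≡n j m)
        split : poch (c * q) q (suc k) ≡ Pj * poch (c * q ^ suc j) q m
        split = trans (cong (poch (c * q) q) (sym j+m≡))
                      (trans (poch-+ (c * q) q j m) (cong (λ x → Pj * poch x q m) (ℚ.*-assoc c q (q ^ j))))
        Pj≢0 : Pj ≢ 0ℚ
        Pj≢0 = *-≢0⇒≢0ʳ (1ℚ - c) (subst (_≢ 0ℚ) (poch-suc c q j) (poch-c≢0 j≤N))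
        regroup : ∀ P Q v i t ι → P * Q * (v * i * t * ι) ≡ v * (Q * (t * ι)) * (P * i)
        regroup = solve-∀ ℚ-ring

≤ᵇ-true : ∀ {m n} → m ≤ n → (m ℕ.≤ᵇ n) ≡ true
≤ᵇ-true m≤n = Equivalence.to T-≡ (ℕ.≤⇒≤ᵇ m≤n)

≤ᵇ-false : ∀ {m n} → n ℕ.< m → (m ℕ.≤ᵇ n) ≡ false
≤ᵇ-false {m} {n} n<m = ¬-not (λ m≤ᵇn → ℕ.<⇒≱ n<m (ℕ.≤ᵇ⇒≤ m n (Equivalence.from T-≡ m≤ᵇn)))

key-< : ∀ p x → val x ℕ.< val p → key x ≤ key p
key-< (M , y) (m , x) m<M =
  ℕ.≤-trans (ℕ.+-monoʳ-≤ (3 ℕ.* m) (rank≤3 x))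
  (ℕ.≤-trans (ℕ.≤-reflexive (trans (ℕ.+-comm (3 ℕ.* m) 3) (sym (ℕ.*-suc 3 m))))
  (ℕ.≤-trans (ℕ.*-monoʳ-≤ 3 m<M) (ℕ.m≤m+n (3 ℕ.* M) (rank y))))
  where
  rank≤3 : ∀ x → rank x ≤ 3
  rank≤3 ca = z≤n
  rank≤3 cc = s≤s z≤n
  rank≤3 cd = s≤s (s≤s z≤n)

pairOK-true : ∀ p x → val x ℕ.+ Cgap (col p) (col x) ≤ val p → key x ≤ key p → pairOK p x ≡ true
pairOK-true p x gap ord rewrite ≤ᵇ-true ord | ≤ᵇ-true gap = refl

pairOK-false : ∀ p x → val p ℕ.< val x ℕ.+ Cgap (col p) (col x) → pairOK p x ≡ false
pairOK-false p x gap rewrite ≤ᵇ-false gap = ∧-zeroʳ (key x ℕ.≤ᵇ key p)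

pairOK-far : ∀ p x → val x ℕ.+ 2 ≤ val p → pairOK p x ≡ true
pairOK-far p x x+2≤p =
  pairOK-true p x (ℕ.≤-trans (ℕ.+-monoʳ-≤ (val x) (Cgap≤2 (col p) (col x))) x+2≤p)
                  (key-< p x (ℕ.<-≤-trans (ℕ.m<m+n (val x) (s≤s z≤n)) x+2≤p))
  where
  Cgap≤2 : ∀ x y → Cgap x y ≤ 2
  Cgap≤2 ca _  = ℕ.≤-refl
  Cgap≤2 cc ca = s≤s z≤n
  Cgap≤2 cc cc = s≤s z≤n
  Cgap≤2 cc cd = ℕ.≤-refl
  Cgap≤2 cd ca = z≤n
  Cgap≤2 cd cc = s≤s z≤n
  Cgap≤2 cd cd = ℕ.≤-refl

follows : CInt → List CInt → Bool
follows p []       = true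
follows p (p′ ∷ s) = pairOK p p′ ∧ isC (p′ ∷ s)

isC-cons : ∀ p → 1 ≤ val p → ∀ s → isC (p ∷ s) ≡ follows p s
isC-cons p 1≤p []       = ≤ᵇ-true 1≤p
isC-cons p 1≤p (p′ ∷ s) rewrite ≤ᵇ-true 1≤p = refl

FollowableBy : CInt → CInt → Set
FollowableBy p x = pairOK p x ≡ true × 1 ≤ val x

colouredDesc-far : ∀ p m → m ℕ.+ 2 ≤ val p → All (FollowableBy p) (colouredDesc m)
colouredDesc-far p zero    _  = []
colouredDesc-far p (suc m) le = far cd ∷ far cc ∷ far ca ∷ colouredDesc-far p m (ℕ.<⇒≤ le)
  where
  far : ∀ y → FollowableBy p (suc m , y)
  far y = pairOK-far p (suc m , y) le , s≤s z≤n

module Colourings (q a c d : ℚ) where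

  W : List CInt → ℚ
  W = weight q a c d

  colour : Colour → ℚ
  colour ca = a
  colour cc = c
  colour cd = d

  wt : CInt → ℚ
  wt (m , x) = q ^ m * colour x

  W-cons : ∀ p s → W (p ∷ s) ≡ wt p * W s
  W-cons (m , ca) s = refl
  W-cons (m , cc) s = refl
  W-cons (m , cd) s = refl

  count : (List CInt → Bool) → List (List CInt) → ℚ
  count P []       = 0ℚ
  count P (s ∷ ss) = (if P s then W s else 0ℚ) + count P ss

  count-cong : ∀ P Q ss → (∀ s → P s ≡ Q s) → count P ss ≡ count Q ss
  count-cong P Q []       P≗Q = refl
  count-cong P Q (s ∷ ss) P≗Q rewrite P≗Q s = cong ((if Q s then W s else 0ℚ) +_) (count-cong P Q ss P≗Q)

  count-++ : ∀ P xs ys → count P (xs ++ ys) ≡ count P xs + count P ys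
  count-++ P []       ys = sym (ℚ.+-identityˡ _)
  count-++ P (x ∷ xs) ys =
    trans (cong ((if P x then W x else 0ℚ) +_) (count-++ P xs ys)) (sym (ℚ.+-assoc (if P x then W x else 0ℚ) _ _))

  count-map-∷ : ∀ P p ss → count P (List.map (p ∷_) ss) ≡ wt p * count (λ s → P (p ∷ s)) ss
  count-map-∷ P p []       = sym (ℚ.*-zeroʳ (wt p))
  count-map-∷ P p (s ∷ ss) with P (p ∷ s)
  ... | true  = trans (cong₂ _+_ (W-cons p s) (count-map-∷ P p ss)) (sym (ℚ.*-distribˡ-+ (wt p) (W s) _))
  ... | false = trans (cong₂ _+_ (sym (ℚ.*-zeroʳ (wt p))) (count-map-∷ P p ss)) (sym (ℚ.*-distribˡ-+ (wt p) 0ℚ _))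

  count-false : ∀ ss → count (λ _ → false) ss ≡ 0ℚ
  count-false []       = refl
  count-false (s ∷ ss) = trans (ℚ.+-identityˡ _) (count-false ss)

  count-filter : ∀ P ss → List.foldr _+_ 0ℚ (List.map W (List.filter (λ s → P s Bool.≟ true) ss)) ≡ count P ss
  count-filter P []       = refl
  count-filter P (s ∷ ss) with P s
  ... | true  = cong (W s +_) (count-filter P ss)
  ... | false = trans (count-filter P ss) (sym (ℚ.+-identityˡ _))

  gf : (List CInt → Bool) → List CInt → ℚ
  gf P xs = count P (sublists xs)

  gf-∷ : ∀ P p xs → gf P (p ∷ xs) ≡ wt p * gf (λ s → P (p ∷ s)) xs + gf P xs
  gf-∷ P p xs = trans (count-++ P (List.map (p ∷_) (sublists xs)) (sublists xs))
                      (cong (_+ gf P xs) (count-map-∷ P p (sublists xs)))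

  gf-isC-∷ : ∀ p xs → 1 ≤ val p → gf isC (p ∷ xs) ≡ wt p * gf (follows p) xs + gf isC xs
  gf-isC-∷ p xs 1≤p = trans (gf-∷ isC p xs) (cong (λ t → wt p * t + gf isC xs) (count-cong _ _ (sublists xs) (isC-cons p 1≤p)))

  gf-follows-take : ∀ p x xs → pairOK p x ≡ true → 1 ≤ val x →
                    gf (follows p) (x ∷ xs) ≡ wt x * gf (follows x) xs + gf (follows p) xs
  gf-follows-take p x xs ok 1≤x = trans (gf-∷ (follows p) x xs)
    (cong (λ t → wt x * t + gf (follows p) xs)
          (count-cong _ _ (sublists xs) (λ s → trans (cong (_∧ isC (x ∷ s)) ok) (isC-cons x 1≤x s))))

  gf-follows-skip : ∀ p x xs → pairOK p x ≡ false → gf (follows p) (x ∷ xs) ≡ gf (follows p) xs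
  gf-follows-skip p x xs ¬ok = begin
    gf (follows p) (x ∷ xs)
      ≡⟨ gf-∷ (follows p) x xs ⟩
    wt x * count (λ s → pairOK p x ∧ isC (x ∷ s)) (sublists xs) + gf (follows p) xs
      ≡⟨ cong (λ t → wt x * t + gf (follows p) xs)
              (trans (count-cong _ (λ _ → false) (sublists xs) (λ s → cong (_∧ isC (x ∷ s)) ¬ok)) (count-false (sublists xs))) ⟩
    wt x * 0ℚ + gf (follows p) xs
      ≡⟨ trans (cong (_+ gf (follows p) xs) (ℚ.*-zeroʳ (wt x))) (ℚ.+-identityˡ _) ⟩
    gf (follows p) xs ∎

  gf-follows-free : ∀ p xs → All (FollowableBy p) xs → gf (follows p) xs ≡ gf isC xs
  gf-follows-free p []       []                  = refl
  gf-follows-free p (x ∷ xs) ((ok , 1≤x) ∷ free) = begin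
    gf (follows p) (x ∷ xs)                       ≡⟨ gf-follows-take p x xs ok 1≤x ⟩
    wt x * gf (follows x) xs + gf (follows p) xs  ≡⟨ cong (wt x * gf (follows x) xs +_) (gf-follows-free p xs free) ⟩
    wt x * gf (follows x) xs + gf isC xs          ≡⟨ sym (gf-isC-∷ x xs 1≤x) ⟩
    gf isC (x ∷ xs)                               ∎

  G : ℕ → ℚ
  G k = gf isC (colouredDesc k)

  After : Colour → ℕ → ℚ
  After x k = gf (follows (suc k , x)) (colouredDesc k)

  -- z (k+1) = G_k, shifted so that the recurrences hold from k = 0 on
  z : ℕ → ℚ
  z zero    = 1ℚ
  z (suc k) = G k

  T : ℕ → ℚ
  T = After cc

  GC≡z : ∀ k → GC k q a c d ≡ z (suc k)
  GC≡z k = count-filter isC (sublists (colouredDesc k))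

  After-a : ∀ k → After ca k ≡ z k
  After-a zero    = refl
  After-a (suc m) = begin
    gf (follows p) ((suc m , cd) ∷ (suc m , cc) ∷ (suc m , ca) ∷ colouredDesc m)
      ≡⟨ gf-follows-skip p (suc m , cd) ((suc m , cc) ∷ (suc m , ca) ∷ colouredDesc m) (pairOK-false p (suc m , cd) too-close) ⟩
    gf (follows p) ((suc m , cc) ∷ (suc m , ca) ∷ colouredDesc m)
      ≡⟨ gf-follows-skip p (suc m , cc) ((suc m , ca) ∷ colouredDesc m) (pairOK-false p (suc m , cc) too-close) ⟩
    gf (follows p) ((suc m , ca) ∷ colouredDesc m)
      ≡⟨ gf-follows-skip p (suc m , ca) (colouredDesc m) (pairOK-false p (suc m , ca) too-close) ⟩
    gf (follows p) (colouredDesc m)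
      ≡⟨ gf-follows-free p (colouredDesc m) (colouredDesc-far p m (ℕ.≤-reflexive (ℕ.+-comm m 2))) ⟩
    G m ∎
    where
    p = (suc (suc m) , ca)
    too-close : suc (suc m) ℕ.< suc m ℕ.+ 2
    too-close = ℕ.≤-reflexive (ℕ.+-comm 2 (suc m))

  After-suc : ∀ m x → Cgap x cd ≡ 2 → Cgap x cc ≤ 1 → Cgap x ca ≤ 1 →
              After x (suc m) ≡ wt (suc m , cc) * T m + (wt (suc m , ca) * z m + G m)
  After-suc m x gap-d gap-c gap-a = begin
    gf (follows p) ((suc m , cd) ∷ (suc m , cc) ∷ (suc m , ca) ∷ colouredDesc m)
      ≡⟨ gf-follows-skip p (suc m , cd) ((suc m , cc) ∷ (suc m , ca) ∷ colouredDesc m)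
           (pairOK-false p (suc m , cd) (ℕ.≤-reflexive (trans (ℕ.+-comm 2 (suc m)) (cong (suc m ℕ.+_) (sym gap-d))))) ⟩
    gf (follows p) ((suc m , cc) ∷ (suc m , ca) ∷ colouredDesc m)
      ≡⟨ gf-follows-take p (suc m , cc) ((suc m , ca) ∷ colouredDesc m) (next cc gap-c) (s≤s z≤n) ⟩
    wt (suc m , cc) * gf (follows (suc m , cc)) ((suc m , ca) ∷ colouredDesc m) + gf (follows p) ((suc m , ca) ∷ colouredDesc m)
      ≡⟨ cong₂ (λ x y → wt (suc m , cc) * x + y)
           (gf-follows-skip (suc m , cc) (suc m , ca) (colouredDesc m) (pairOK-false (suc m , cc) (suc m , ca) (ℕ.≤-reflexive (ℕ.+-comm 1 (suc m)))))
           (gf-follows-take p (suc m , ca) (colouredDesc m) (next ca gap-a) (s≤s z≤n)) ⟩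
    wt (suc m , cc) * T m + (wt (suc m , ca) * After ca m + gf (follows p) (colouredDesc m))
      ≡⟨ cong₂ (λ x y → wt (suc m , cc) * T m + (wt (suc m , ca) * x + y))
           (After-a m) (gf-follows-free p (colouredDesc m) (colouredDesc-far p m (ℕ.≤-reflexive (ℕ.+-comm m 2)))) ⟩
    wt (suc m , cc) * T m + (wt (suc m , ca) * z m + G m) ∎
    where
    p = (suc (suc m) , x)
    next : ∀ y → Cgap x y ≤ 1 → pairOK p (suc m , y) ≡ true
    next y gap = pairOK-true p (suc m , y) (ℕ.≤-trans (ℕ.+-monoʳ-≤ (suc m) gap) (ℕ.≤-reflexive (ℕ.+-comm (suc m) 1)))
                                           (key-< p (suc m , y) ℕ.≤-refl)

  T-suc : ∀ m → T (suc m) ≡ c * q ^ suc m * T m + a * q ^ suc m * z m + z (suc m)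
  T-suc m = trans (After-suc m cc refl (s≤s z≤n) (s≤s z≤n)) (regroup (q ^ suc m) a c (T m) (z m) (G m))
    where
    regroup : ∀ Q a c t z g → Q * c * t + (Q * a * z + g) ≡ c * Q * t + a * Q * z + g
    regroup = solve-∀ ℚ-ring

  After-d≡T : ∀ k → After cd k ≡ T k
  After-d≡T zero    = refl
  After-d≡T (suc m) = trans (After-suc m cd refl (s≤s z≤n) z≤n) (sym (After-suc m cc refl (s≤s z≤n) (s≤s z≤n)))

  z-suc : ∀ m → z (suc (suc m)) ≡ z (suc m) + a * q ^ suc m * (1ℚ + d * q ^ suc m) * z m + (c + d) * q ^ suc m * T m
  z-suc m = begin
    gf isC (d₁ ∷ c₁ ∷ a₁ ∷ colouredDesc m)
      ≡⟨ gf-isC-∷ d₁ (c₁ ∷ a₁ ∷ colouredDesc m) (s≤s z≤n) ⟩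
    wt d₁ * gf (follows d₁) (c₁ ∷ a₁ ∷ colouredDesc m) + gf isC (c₁ ∷ a₁ ∷ colouredDesc m)
      ≡⟨ cong₂ (λ x y → wt d₁ * x + y)
           (trans (gf-follows-skip d₁ c₁ (a₁ ∷ colouredDesc m) (pairOK-false d₁ c₁ same-value))
                  (gf-follows-take d₁ a₁ (colouredDesc m) (pairOK-true d₁ a₁ (ℕ.≤-reflexive (ℕ.+-identityʳ (suc m))) (ℕ.+-monoʳ-≤ (3 ℕ.* suc m) z≤n)) (s≤s z≤n)))
           (trans (gf-isC-∷ c₁ (a₁ ∷ colouredDesc m) (s≤s z≤n))
                  (cong₂ (λ x y → wt c₁ * x + y)
                         (gf-follows-skip c₁ a₁ (colouredDesc m) (pairOK-false c₁ a₁ same-value))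
                         (gf-isC-∷ a₁ (colouredDesc m) (s≤s z≤n)))) ⟩
    wt d₁ * (wt a₁ * After ca m + After cd m) + (wt c₁ * T m + (wt a₁ * After ca m + G m))
      ≡⟨ cong₂ (λ x y → wt d₁ * (wt a₁ * x + y) + (wt c₁ * T m + (wt a₁ * x + G m))) (After-a m) (After-d≡T m) ⟩
    wt d₁ * (wt a₁ * z m + T m) + (wt c₁ * T m + (wt a₁ * z m + G m))
      ≡⟨ regroup (q ^ suc m) a c d (z m) (G m) (T m) ⟩
    z (suc m) + a * q ^ suc m * (1ℚ + d * q ^ suc m) * z m + (c + d) * q ^ suc m * T m ∎
    where
    d₁ = (suc m , cd)
    c₁ = (suc m , cc)
    a₁ = (suc m , ca)
    same-value : suc m ℕ.< suc m ℕ.+ 1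
    same-value = ℕ.m<m+n (suc m) (s≤s z≤n)
    regroup : ∀ Q a c d z g t → Q * d * (Q * a * z + t) + (Q * c * t + (Q * a * z + g))
                              ≡ g + a * Q * (1ℚ + d * Q) * z + (c + d) * Q * t
    regroup = solve-∀ ℚ-ring

  z-step : ∀ n → z (4 ℕ.+ n) ≡ Recurrence.step q a c d (q ^ n) (z n) (z (1 ℕ.+ n)) (z (2 ℕ.+ n)) (z (3 ℕ.+ n))
  z-step n = Recurrence.coupled⇒step q a c d (q ^ n) (T-suc n) (z-suc n) (T-suc (suc n)) (z-suc (suc n)) (z-suc (suc (suc n)))

initial-value₂ : ∀ (q a c d : ℚ) →
  let x₁ = q * 1ℚ in
  c * x₁ * 1ℚ + (1ℚ + a * x₁) * (1ℚ + d * x₁) ≡ 1ℚ + a * x₁ * (1ℚ + d * x₁) * 1ℚ + (c + d) * x₁ * 1ℚ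
initial-value₂ = solve-∀ ℚ-ring

initial-value₃ : ∀ (q a c d : ℚ) →
  let x₁  = q * 1ℚ
      x₂  = q * x₁
      z₂  = 1ℚ + a * x₁ * (1ℚ + d * x₁) * 1ℚ + (c + d) * x₁ * 1ℚ
      t₁  = c * x₁ * 1ℚ + a * x₁ * 1ℚ + 1ℚ
      Q₁₁ = q * 1ℚ * 1ℚ + 1ℚ * (1ℚ - c * x₁) * 1ℚ
      Q₂₁ = q * 1ℚ * Q₁₁ + 1ℚ * (1ℚ - c * x₁) * 1ℚ
  in c * x₂ * z₂ + (1ℚ + (a + d) * q * Q₁₁ + a * d * (q * q) * Q₂₁ + c * x₁ * ((1ℚ + a * x₁) * (1ℚ + d * x₁)))
     ≡ z₂ + a * x₂ * (1ℚ + d * x₂) * 1ℚ + (c + d) * x₂ * t₁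
initial-value₃ = solve-∀ ℚ-ring

module _ (q a c d : ℚ) {N : ℕ} (q^i≢1 : ∀ i → 1 ≤ i → i ≤ N → q ^ i ≢ 1ℚ) where
  open Recurrence q a c d
  open Series q a c d
  open Colourings q a c d

  R≡z-2 : 2 ≤ N → R 2 ≡ z 2
  R≡z-2 le = begin
    R 2                       ≡⟨ R-suc q^i≢1 le ⟩
    c * q ^ 1 * R 1 + Y 1     ≡⟨ cong₂ (λ r y → c * q ^ 1 * r + y) (R-one q^i≢1 (ℕ.<⇒≤ le)) (Y-one q^i≢1 le) ⟩
    c * q ^ 1 * 1ℚ + g 1      ≡⟨ initial-value₂ q a c d ⟩
    z 1 + a * q ^ 1 * (1ℚ + d * q ^ 1) * z 0 + (c + d) * q ^ 1 * T 0 ≡⟨ sym (z-suc 0) ⟩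
    z 2                       ∎

  R≡z-3 : 3 ≤ N → R 3 ≡ z 3
  R≡z-3 le = begin
    R 3
      ≡⟨ R-suc q^i≢1 le ⟩
    c * q ^ 2 * R 2 + Y 2
      ≡⟨ cong₂ (λ r y → c * q ^ 2 * r + y) (trans (R≡z-2 le₂) (z-suc 0)) Y₂ ⟩
    c * q ^ 2 * (z 1 + a * q ^ 1 * (1ℚ + d * q ^ 1) * z 0 + (c + d) * q ^ 1 * T 0)
      + (1ℚ + (a + d) * q * qstep 1ℚ 1ℚ 1ℚ + a * d * (q * q) * qstep 1ℚ 1ℚ (qstep 1ℚ 1ℚ 1ℚ) + c * q ^ 1 * g 1)
      ≡⟨ initial-value₃ q a c d ⟩
    (z 1 + a * q ^ 1 * (1ℚ + d * q ^ 1) * z 0 + (c + d) * q ^ 1 * T 0)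
      + a * q ^ 2 * (1ℚ + d * q ^ 2) * z 1 + (c + d) * q ^ 2 * (c * q ^ 1 * T 0 + a * q ^ 1 * z 0 + z 1)
      ≡⟨ cong₂ (λ z₂ t₁ → z₂ + a * q ^ 2 * (1ℚ + d * q ^ 2) * z 1 + (c + d) * q ^ 2 * t₁) (sym (z-suc 0)) (sym (T-suc 0)) ⟩
    z 2 + a * q ^ 2 * (1ℚ + d * q ^ 2) * z 1 + (c + d) * q ^ 2 * T 1
      ≡⟨ sym (z-suc 1) ⟩
    z 3 ∎
    where
    le₂ = ℕ.<⇒≤ le
    le₁ = ℕ.<⇒≤ le₂
    Q₁₁ : Q₁ 1 ≡ qstep 1ℚ 1ℚ 1ℚ
    Q₁₁ = trans (Q₁-suc q^i≢1 le₁) (cong (qstep 1ℚ 1ℚ) (R-one q^i≢1 le₁))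
    Y₂ : Y 2 ≡ 1ℚ + (a + d) * q * qstep 1ℚ 1ℚ 1ℚ + a * d * (q * q) * qstep 1ℚ 1ℚ (qstep 1ℚ 1ℚ 1ℚ) + c * q ^ 1 * g 1
    Y₂ = begin
      Y 2
        ≡⟨ Y-suc q^i≢1 le ⟩
      H 1 + c * q ^ 1 * Y 1
        ≡⟨ cong₂ (λ h y → h + c * q ^ 1 * y) (H-split 1) (Y-one q^i≢1 le₂) ⟩
      R 1 + (a + d) * q * Q₁ 1 + a * d * (q * q) * Q₂ 1 + c * q ^ 1 * g 1
        ≡⟨ cong₂ (λ r Q → r + (a + d) * q * Q₁ 1 + a * d * (q * q) * Q + c * q ^ 1 * g 1)
                 (R-one q^i≢1 le₁) (trans (Q₂-suc q^i≢1 le₁) (cong (qstep 1ℚ 1ℚ) Q₁₁)) ⟩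
      1ℚ + (a + d) * q * Q₁ 1 + a * d * (q * q) * qstep 1ℚ 1ℚ (qstep 1ℚ 1ℚ 1ℚ) + c * q ^ 1 * g 1
        ≡⟨ cong (λ Q → 1ℚ + (a + d) * q * Q + a * d * (q * q) * qstep 1ℚ 1ℚ (qstep 1ℚ 1ℚ 1ℚ) + c * q ^ 1 * g 1) Q₁₁ ⟩
      1ℚ + (a + d) * q * qstep 1ℚ 1ℚ 1ℚ + a * d * (q * q) * qstep 1ℚ 1ℚ (qstep 1ℚ 1ℚ 1ℚ) + c * q ^ 1 * g 1 ∎

  R≡z : ∀ n → n ≤ N → R n ≡ z n
  R≡z 0 _  = refl
  R≡z 1 le = R-one q^i≢1 le
  R≡z 2 le = R≡z-2 le
  R≡z 3 le = R≡z-3 le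
  R≡z (suc (suc (suc (suc n)))) le = begin
    R (4 ℕ.+ n)
      ≡⟨ R-step q^i≢1 n le ⟩
    step (q ^ n) (R n) (R (1 ℕ.+ n)) (R (2 ℕ.+ n)) (R (3 ℕ.+ n))
      ≡⟨ step-cong (q ^ n) (R≡z n (lower 4)) (R≡z (suc n) (lower 3)) (R≡z (suc (suc n)) (lower 2)) (R≡z (suc (suc (suc n))) (lower 1)) ⟩
    step (q ^ n) (z n) (z (1 ℕ.+ n)) (z (2 ℕ.+ n)) (z (3 ℕ.+ n))
      ≡⟨ sym (z-step n) ⟩
    z (4 ℕ.+ n) ∎
    where
    lower : ∀ i → 4 ℕ.+ n ∸ i ≤ N
    lower i = ℕ.≤-trans (ℕ.m∸n≤m (4 ℕ.+ n) i) le

theorem1p12 : (k : ℕ) → k ≥ 1 → (q a c d : ℚ)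
    → (∀ i → 1 ≤ i → i ≤ suc k → q ^ i ≢ 1ℚ)
    → (∀ i → i ≤ suc k → c * q ^ i ≢ 1ℚ)
    → GC k q a c d ≡ RHS k q a c d
theorem1p12 k _ q a c d q^i≢1 c*q^i≢1 = begin
  GC k q a c d                  ≡⟨ Colourings.GC≡z q a c d k ⟩
  Colourings.z q a c d (suc k)  ≡⟨ sym (R≡z q a c d q^i≢1 (suc k) ℕ.≤-refl) ⟩
  Series.R q a c d (suc k)      ≡⟨ sym (UFormula.RHS≡R q a c d c*q^i≢1 k ℕ.≤-refl) ⟩
  RHS k q a c d                 ∎
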